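{- Let $\theta_1$ and $\theta_2$ be substitutions that are arity type compatible relative to the arity context $\Theta$ and let $\Theta'=\mathrm{ctx}(\theta_2\circ\theta_1)\oplus\Theta$. (1) If $E$ is a canonical kind, type or context that respects $\Theta'$ and $E'$, $E''$ are such that $\theta_1(E)\rightsquigarrow E'$ and $\theta_2(E')\rightsquigarrow E''$ are derivable, then $(\theta_2\circ\theta_1)(E)\rightsquigarrow E''$ is derivable. (2) If $M$ is a canonical term such that $\Theta'\vdash M\Leftarrow\alpha$ is derivable for some arity type $\alpha$, and $M'$, $M''$ are canonical terms such that $\theta_1(M)\rightsquigarrow M'$ and $\theta_2(M')\rightsquigarrow M''$ are derivable, then $(\theta_2\circ\theta_1)(M)\rightsquigarrow M''$ is derivable. (3) If $R$ is an atomic term such that $\Theta'\vdash R\Leftarrow\alpha$ is derivable for some arity type $\alpha$, and (a) $M'$, $M''$ are canonical terms such that $\theta_1(R)\rightsquigarrow_r M':\alpha$ and $\theta_2(M')\rightsquigarrow M''$ are derivable, then $(\theta_2\circ\theta_1)(R)\rightsquigarrow_r M'':\alpha$ is derivable; (b) $R'$ atomic and $M''$ canonical are such that $\theta_1(R)\rightsquigarrow_r R'$ and $\theta_2(R')\rightsquigarrow_r M'':\alpha$ are derivable, then $(\theta_2\circ\theta_1)(R)\rightsquigarrow_r M'':\alpha$ is derivable; (c) $R'$, $R''$ are atomic terms such that $\theta_1(R)\rightsquigarrow_r R'$ and $\theta_2(R')\rightsquigarrow_r R''$ are derivable, then $(\theta_2\circ\theta_1)(R)\rightsquigarrow_r R''$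 is derivable.
   Context: Canonical LF syntax: kinds $K ::= \mathrm{Type}\mid \Pi x{:}A.K$; canonical types $A ::= P \mid \Pi x{:}A_1.A_2$; atomic types $P ::= a\mid P\,M$; canonical terms $M ::= R\mid \lambda x.M$; atomic terms $R ::= c\mid x\mid R\,M$; contexts $\Gamma ::=\cdot\mid\Gamma,x{:}A$ ($c$ term constants, $a$ type constants, $x$ variables; identification up to renaming of bound variables). Arity types: $\alpha ::= o\mid \alpha\to\alpha$; erasure: $P^-=o$, $(\Pi x{:}A_1.A_2)^-=A_1^-\to A_2^-$. A substitution $\theta$ is a finite set $\{\langle x_i,M_i,\alpha_i\rangle\}$ with distinct variables $x_i$, canonical terms $M_i$, arity types $\alpha_i$; $\mathrm{dom}(\theta)=\{x_i\}$, $\mathrm{rng}(\theta)=\{M_i\}$, $\mathrm{ctx}(\theta)=\{x_i:\alpha_i\}$. Hereditary substitution judgements $\theta(M)\rightsquigarrow M'$, $\theta(R)\rightsquigarrow_r R'$, $\theta(R)\rightsquigarrow_r M':\alpha'$ are defined inductively by: if $\theta(R)\rightsquigarrow_r R'$ then $\theta(R)\rightsquigarrow R'$; if $\theta(R)\rightsquigarrow_r M':\alpha'$ then $\theta(R)\rightsquigarrow M'$; $\theta(\lambda x.M)\rightsquigarrow\lambda x.M'$ if $x\notin\mathrm{dom}(\theta)$, $x$ not free in $\mathrm{rng}(\theta)$, and $\theta(M)\rightsquigarrow M'$; $\theta(x)\rightsquigarrow_r M:\alpha$ if $\langle x,M,\alpha\rangle\in\theta$; $\theta(R\,M)\rightsquigarrow_r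 M''':\alpha''$ if $\theta(R)\rightsquigarrow_r\lambda x.M':\alpha'\to\alpha''$, $\theta(M)\rightsquigarrow M''$, $\{\langle x,M'',\alpha'\rangle\}(M')\rightsquigarrow M'''$; $\theta(c)\rightsquigarrow_r c$; $\theta(x)\rightsquigarrow_r x$ if $x\notin\mathrm{dom}(\theta)$; $\theta(R\,M)\rightsquigarrow_r R'\,M'$ if $\theta(R)\rightsquigarrow_r R'$ and $\theta(M)\rightsquigarrow M'$. On types/kinds it distributes to the terms ($\theta(a)\rightsquigarrow a$; $\theta(P\,M)\rightsquigarrow P'\,M'$; $\theta(\Pi x{:}A_1.A_2)\rightsquigarrow\Pi x{:}A_1'.A_2'$ with $x$ not in $\mathrm{dom}(\theta)$ nor free in $\mathrm{rng}(\theta)$; $\theta(\mathrm{Type})\rightsquigarrow\mathrm{Type}$; similarly for $\Pi x{:}A.K$); on contexts $\theta(\cdot)\rightsquigarrow\cdot$ and $\theta(\Gamma,x{:}A)\rightsquigarrow\Gamma',x{:}A'$ if $x$ is not in $\mathrm{dom}(\theta)$ nor free in $\mathrm{rng}(\theta)$, $\theta(\Gamma)\rightsquigarrow\Gamma'$, $\theta(A)\rightsquigarrow A'$. Arity contexts $\Theta$ are sets of unique assignments $x:\alpha$, $c:\alpha$; $\Theta_1\oplus\Theta_2$ is $\Theta_1$ together with the assignments of $\Theta_2$ to symbols not assigned in $\Theta_1$. Arity typing: $\Theta\vdash c\Rightarrow\alpha$ if $c:\alpha\in\Theta$; $\Theta\vdash x\Rightarrow\alpha$ if $x:\alpha\in\Theta$;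 $\Theta\vdash R\,M\Rightarrow\alpha$ if $\Theta\vdash R\Rightarrow\alpha'\to\alpha$ and $\Theta\vdash M\Leftarrow\alpha'$; $\Theta\vdash\lambda x.M\Leftarrow\alpha_1\to\alpha_2$ if $\{x:\alpha_1\}\oplus\Theta\vdash M\Leftarrow\alpha_2$; $\Theta\vdash R\Leftarrow o$ if $\Theta\vdash R\Rightarrow o$. A kind or type $E$ respects $\Theta$ if $E=\mathrm{Type}$, or $E$ is atomic and each term argument $M$ in it has $\Theta\vdash M\Leftarrow\alpha$ for some $\alpha$, or $E=\Pi x{:}A.E'$ with $A$ respecting $\Theta$ and $E'$ respecting $\{x:A^-\}\oplus\Theta$; a context respects $\Theta$ if every type in it does. $\theta$ is arity type preserving with respect to $\Theta$ if $\Theta\vdash M\Leftarrow\alpha$ for each $\langle x,M,\alpha\rangle\in\theta$. Substitutions $\theta_1,\theta_2$ are arity type compatible relative to $\Theta$ if $\theta_2$ is arity type preserving with respect to $\Theta$ and $\theta_1$ is arity type preserving with respect to $\mathrm{ctx}(\theta_2)\oplus\Theta$; their composition is $\theta_2\circ\theta_1=\{\langle x,M',\alpha\rangle\mid \langle x,M,\alpha\rangle\in\theta_1,\ \theta_2(M)\rightsquigarrow M'\}\cup\{\langle y,N,\beta\rangle\in\theta_2\mid y\notin\mathrm{dom}(\theta_1)\}$ (well defined under compatibility). -}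

module Defs where

-- Canonical LF syntax in locally nameless form (bound variables are de Bruijn
-- indices `bv`, free variables are names `fv`), so that terms, types and kinds
-- are identified up to renaming of bound variables by construction.

open import Data.Nat using (ℕ; zero; suc; _≡ᵇ_)
open import Data.Bool using (Bool; true; false; if_then_else_; _∨_)
open import Data.List using (List; []; _∷_; _++_; map)
open import Data.List.Membership.Propositional using (_∈_; _∉_)
open import Data.List.Relation.Unary.All using (All)
open import Data.List.Relation.Unary.Unique.Propositional using (Unique)
open import Data.Product using (Σ; _×_; _,_; proj₁; proj₂; ∃)
open import Data.Sum using (_⊎_)
open import Data.Unit using (⊤)

Name : Set
Name = ℕ
Con : Set
Con = ℕ
TCon : Set
TCon = ℕ

mutual
  -- canonical terms  M ::= R | λx.M   (λ binds de Bruijn index 0)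
  data Can : Set where
    atm : Atm → Can
    lam : Can → Can

  -- atomic terms  R ::= c | x | R M   (plus locally-nameless bound indices)
  data Atm : Set where
    con : Con → Atm
    fv  : Name → Atm
    bv  : ℕ → Atm
    app : Atm → Can → Atm

data ATy : Set where
  tcon : TCon → ATy
  tapp : ATy → Can → ATy

-- canonical types  A ::= P | Πx:A₁.A₂   (Π binds index 0 in A₂)
data Ty : Set where
  atyp : ATy → Ty
  pi   : Ty → Ty → Ty

data Kind : Set where
  type : Kind
  piK  : Ty → Kind → Kind

data Ctx : Set where
  ∅     : Ctx
  _,_∶_ : Ctx → Name → Ty → Ctx

mutual
  fvsC : Can → List Name
  fvsC (atm R) = fvsA R
  fvsC (lam M) = fvsC M

  fvsA : Atm → List Name
  fvsA (con c)   = []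
  fvsA (fv x)    = x ∷ []
  fvsA (bv i)    = []
  fvsA (app R M) = fvsA R ++ fvsC M

fvsP : ATy → List Name
fvsP (tcon a)   = []
fvsP (tapp P M) = fvsP P ++ fvsC M

fvsT : Ty → List Name
fvsT (atyp P)    = fvsP P
fvsT (pi A₁ A₂)  = fvsT A₁ ++ fvsT A₂

fvsK : Kind → List Name
fvsK type        = []
fvsK (piK A K)   = fvsT A ++ fvsK K

mutual
  openC : ℕ → Name → Can → Can
  openC k x (atm R) = atm (openA k x R)
  openC k x (lam M) = lam (openC (suc k) x M)

  openA : ℕ → Name → Atm → Atm
  openA k x (con c)   = con c
  openA k x (fv y)    = fv y
  openA k x (bv i)    = if i ≡ᵇ k then fv x else bv i
  openA k x (app R M) = app (openA k x R) (openC k x M)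

openP : ℕ → Name → ATy → ATy
openP k x (tcon a)   = tcon a
openP k x (tapp P M) = tapp (openP k x P) (openC k x M)

openT : ℕ → Name → Ty → Ty
openT k x (atyp P)   = atyp (openP k x P)
openT k x (pi A₁ A₂) = pi (openT k x A₁) (openT (suc k) x A₂)

openK : ℕ → Name → Kind → Kind
openK k x type      = type
openK k x (piK A K) = piK (openT k x A) (openK (suc k) x K)

mutual
  closeC : ℕ → Name → Can → Can
  closeC k x (atm R) = atm (closeA k x R)
  closeC k x (lam M) = lam (closeC (suc k) x M)

  closeA : ℕ → Name → Atm → Atm
  closeA k x (con c)   = con c
  closeA k x (fv y)    = if y ≡ᵇ x then bv k else fv y
  closeA k x (bv i)    = bv i
  closeA k x (app R M) = app (closeA k x R) (closeC k x M)

closeP : ℕ → Name → ATy → ATy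
closeP k x (tcon a)   = tcon a
closeP k x (tapp P M) = tapp (closeP k x P) (closeC k x M)

closeT : ℕ → Name → Ty → Ty
closeT k x (atyp P)   = atyp (closeP k x P)
closeT k x (pi A₁ A₂) = pi (closeT k x A₁) (closeT (suc k) x A₂)

closeK : ℕ → Name → Kind → Kind
closeK k x type      = type
closeK k x (piK A K) = piK (closeT k x A) (closeK (suc k) x K)

infixr 5 _⟶_
data Arity : Set where
  o   : Arity
  _⟶_ : Arity → Arity → Arity

erase : Ty → Arity
erase (atyp P)   = o
erase (pi A₁ A₂) = erase A₁ ⟶ erase A₂

-- Substitutions: finite sets {⟨xᵢ,Mᵢ,αᵢ⟩} represented by lists

Subst : Set
Subst = List (Name × Can × Arity)

dom : Subst → List Name
dom = map proj₁

IsSubst : Subst → Set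
IsSubst θ = Unique (dom θ)

FreshRng : Name → Subst → Set
FreshRng x θ = All (λ t → x ∉ fvsC (proj₁ (proj₂ t))) θ

-- Hereditary substitution judgements
--   SubC θ M M'        : θ(M) ⇝ M'
--   SubR θ R R'        : θ(R) ⇝ᵣ R'
--   SubRC θ R M α      : θ(R) ⇝ᵣ M : α

mutual
  data SubC (θ : Subst) : Can → Can → Set where
    c-atm : ∀ {R R'} → SubR θ R R' → SubC θ (atm R) (atm R')
    c-can : ∀ {R M α} → SubRC θ R M α → SubC θ (atm R) M
    c-lam : ∀ {M N} (x : Name) → x ∉ dom θ → FreshRng x θ → x ∉ fvsC M →
            SubC θ (openC 0 x M) N → SubC θ (lam M) (lam (closeC 0 x N))

  data SubRC (θ : Subst) : Atm → Can → Arity → Set where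
    rc-var : ∀ {x M α} → (x , M , α) ∈ θ → SubRC θ (fv x) M α
    rc-app : ∀ {R M M₁ M'' M''' α' α''} →
             SubRC θ R (lam M₁) (α' ⟶ α'') → SubC θ M M'' →
             (x : Name) → x ∉ fvsC M₁ →
             SubC ((x , M'' , α') ∷ []) (openC 0 x M₁) M''' →
             SubRC θ (app R M) M''' α''

  data SubR (θ : Subst) : Atm → Atm → Set where
    r-con : ∀ {c} → SubR θ (con c) (con c)
    r-var : ∀ {x} → x ∉ dom θ → SubR θ (fv x) (fv x)
    r-app : ∀ {R R' M M'} → SubR θ R R' → SubC θ M M' →
            SubR θ (app R M) (app R' M')

data SubP (θ : Subst) : ATy → ATy → Set where
  p-con : ∀ {a} → SubP θ (tcon a) (tcon a)
  p-app : ∀ {P P' M M'} → SubP θ P P' → SubC θ M M' →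
          SubP θ (tapp P M) (tapp P' M')

data SubT (θ : Subst) : Ty → Ty → Set where
  t-atm : ∀ {P P'} → SubP θ P P' → SubT θ (atyp P) (atyp P')
  t-pi  : ∀ {A₁ A₁' A₂ A₂'} (x : Name) → x ∉ dom θ → FreshRng x θ →
          x ∉ fvsT A₂ → SubT θ A₁ A₁' → SubT θ (openT 0 x A₂) A₂' →
          SubT θ (pi A₁ A₂) (pi A₁' (closeT 0 x A₂'))

data SubK (θ : Subst) : Kind → Kind → Set where
  k-type : SubK θ type type
  k-pi   : ∀ {A A' K K'} (x : Name) → x ∉ dom θ → FreshRng x θ →
           x ∉ fvsK K → SubT θ A A' → SubK θ (openK 0 x K) K' →
           SubK θ (piK A K) (piK A' (closeK 0 x K'))

data SubΓ (θ : Subst) : Ctx → Ctx → Set where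
  g-emp : SubΓ θ ∅ ∅
  g-ext : ∀ {Γ Γ' x A A'} → x ∉ dom θ → FreshRng x θ →
          SubΓ θ Γ Γ' → SubT θ A A' → SubΓ θ (Γ , x ∶ A) (Γ' , x ∶ A')

data Sym : Set where
  var : Name → Sym
  cst : Con → Sym

_≡ˢ_ : Sym → Sym → Bool
var x ≡ˢ var y = x ≡ᵇ y
cst c ≡ˢ cst d = c ≡ᵇ d
_     ≡ˢ _     = false

ArCtx : Set
ArCtx = List (Sym × Arity)

IsArCtx : ArCtx → Set
IsArCtx Θ = Unique (map proj₁ Θ)

assigned : Sym → ArCtx → Bool
assigned s []             = false
assigned s ((t , _) ∷ Θ)  = (t ≡ˢ s) ∨ assigned s Θ

unassignedIn : ArCtx → ArCtx → ArCtx
unassignedIn Θ₁ []              = []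
unassignedIn Θ₁ ((s , α) ∷ Θ₂)  =
  if assigned s Θ₁ then unassignedIn Θ₁ Θ₂ else (s , α) ∷ unassignedIn Θ₁ Θ₂

infixr 5 _⊕_
_⊕_ : ArCtx → ArCtx → ArCtx
Θ₁ ⊕ Θ₂ = Θ₁ ++ unassignedIn Θ₁ Θ₂

ctx : Subst → ArCtx
ctx = map (λ t → (var (proj₁ t) , proj₂ (proj₂ t)))

infix 4 _⊢_⇒_ _⊢_⇐_

mutual
  data _⊢_⇒_ (Θ : ArCtx) : Atm → Arity → Set where
    ⇒con : ∀ {c α} → (cst c , α) ∈ Θ → Θ ⊢ con c ⇒ α
    ⇒var : ∀ {x α} → (var x , α) ∈ Θ → Θ ⊢ fv x ⇒ α
    ⇒app : ∀ {R M α α'} → Θ ⊢ R ⇒ (α' ⟶ α) → Θ ⊢ M ⇐ α' → Θ ⊢ app R M ⇒ α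

  data _⊢_⇐_ (Θ : ArCtx) : Can → Arity → Set where
    ⇐lam : ∀ {M α₁ α₂} (x : Name) → x ∉ fvsC M →
           ((var x , α₁) ∷ []) ⊕ Θ ⊢ openC 0 x M ⇐ α₂ →
           Θ ⊢ lam M ⇐ (α₁ ⟶ α₂)
    ⇐atm : ∀ {R} → Θ ⊢ R ⇒ o → Θ ⊢ atm R ⇐ o

data RespP (Θ : ArCtx) : ATy → Set where
  rp-con : ∀ {a} → RespP Θ (tcon a)
  rp-app : ∀ {P M α} → RespP Θ P → Θ ⊢ M ⇐ α → RespP Θ (tapp P M)

data RespT (Θ : ArCtx) : Ty → Set where
  rt-atm : ∀ {P} → RespP Θ P → RespT Θ (atyp P)
  rt-pi  : ∀ {A₁ A₂} → RespT Θ A₁ → (x : Name) → x ∉ fvsT A₂ →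
           RespT (((var x , erase A₁) ∷ []) ⊕ Θ) (openT 0 x A₂) →
           RespT Θ (pi A₁ A₂)

data RespK (Θ : ArCtx) : Kind → Set where
  rk-type : RespK Θ type
  rk-pi   : ∀ {A K} → RespT Θ A → (x : Name) → x ∉ fvsK K →
            RespK (((var x , erase A) ∷ []) ⊕ Θ) (openK 0 x K) →
            RespK Θ (piK A K)

data RespΓ (Θ : ArCtx) : Ctx → Set where
  rg-emp : RespΓ Θ ∅
  rg-ext : ∀ {Γ x A} → RespΓ Θ Γ → RespT Θ A → RespΓ Θ (Γ , x ∶ A)

ArPres : Subst → ArCtx → Set
ArPres θ Θ = ∀ {x M α} → (x , M , α) ∈ θ → Θ ⊢ M ⇐ α

Compatible : Subst → Subst → ArCtx → Set
Compatible θ₁ θ₂ Θ = ArPres θ₂ Θ × ArPres θ₁ (ctx θ₂ ⊕ Θ)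

-- θ is (a list representation of) the set  θ₂ ∘ θ₁
IsComposition : Subst → Subst → Subst → Set
IsComposition θ₂ θ₁ θ =
  ∀ x M α →
    ((x , M , α) ∈ θ →
       (Σ Can λ M₀ → (x , M₀ , α) ∈ θ₁ × SubC θ₂ M₀ M)
       ⊎ ((x , M , α) ∈ θ₂ × x ∉ dom θ₁))
  × ((Σ Can λ M₀ → (x , M₀ , α) ∈ θ₁ × SubC θ₂ M₀ M)
       ⊎ ((x , M , α) ∈ θ₂ × x ∉ dom θ₁) →
     (x , M , α) ∈ θ)

module Submission where

-- The induction is on a bound for the arities of θ₁ and θ₂ together.  Every case is
-- structural except a head variable of θ₁ applied to arguments, where θ₁ performs
-- β-reductions [N₁/x]M₁ and θ₂ has to be pushed through them.  As x is fresh for θ₂,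
-- both θ₂ ∘ [N₁/x] and [θ₂ N₁/x] ∘ θ₂ are the substitution (x ↦ θ₂ N₁) ∪ θ₂, whose
-- arities have smaller total size, so the induction hypothesis together with
-- determinacy identifies the two results.  Arity typing guarantees that every
-- hereditary substitution needed along the way exists.  The judgements are first
-- transferred to a cofinitely quantified form, which is invariant under swapping names.

open import Defs
open import Data.Nat using (ℕ; zero; suc; _≡ᵇ_; _+_; _≤_; _<_; s≤s; s≤s⁻¹; _≟_)
open import Data.Nat.Properties
  using (≤-refl; ≤-trans; <-irrefl; m≤n⇒m≤1+n; +-comm; m≤m+n; m≤n+m; +-monoˡ-≤;
         ≤∧≢⇒<; m+n≤o⇒m≤o; m+n≤o⇒n≤o; ≡ᵇ⇒≡; ≡⇒≡ᵇ)
open import Data.Bool using (true; false; if_then_else_)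
open import Data.Bool.Properties using (∨-zeroʳ; T-≡)
open import Data.List using (List; []; _∷_; _++_; map)
open import Data.List.Extrema.Nat using (max; xs≤max)
open import Data.List.Membership.Propositional using (_∈_; _∉_)
open import Data.List.Membership.Propositional.Properties using (∈-++⁺ˡ; ∈-++⁺ʳ; ∈-++⁻; ∈-map⁺; ∈-map⁻)
open import Data.List.Membership.DecPropositional _≟_ using (_∈?_)
open import Data.List.Relation.Unary.Any using (here; there)
open import Data.List.Relation.Unary.All using (All; []; _∷_)
import Data.List.Relation.Unary.All as All
open import Data.List.Relation.Unary.All.Properties using (¬Any⇒All¬)
open import Data.List.Relation.Unary.AllPairs using ([]; _∷_)
open import Data.List.Relation.Unary.Unique.Propositional.Properties using (Unique[x∷xs]⇒x∉xs)
open import Data.Product using (Σ; _×_; _,_; proj₁; proj₂)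
import Data.Product as Product
open import Data.Sum using (_⊎_; inj₁; inj₂)
import Data.Sum as Sum
open import Data.Empty using (⊥; ⊥-elim)
open import Data.Unit using (⊤; tt)
open import Function.Bundles using (Equivalence)
open import Relation.Nullary using (yes; no)
open import Relation.Binary.PropositionalEquality

∉-++⁻ˡ : ∀ {A : Set} {x : A} {xs} ys → x ∉ xs ++ ys → x ∉ xs
∉-++⁻ˡ ys x∉ p = x∉ (∈-++⁺ˡ p)

∉-++⁻ʳ : ∀ {A : Set} {x : A} xs {ys} → x ∉ xs ++ ys → x ∉ ys
∉-++⁻ʳ xs x∉ p = x∉ (∈-++⁺ʳ xs p)

∉-++⁻ : ∀ {A : Set} {x : A} xs {ys} → x ∉ xs ++ ys → x ∉ xs × x ∉ ys
∉-++⁻ xs x∉ = ∉-++⁻ˡ _ x∉ , ∉-++⁻ʳ xs x∉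

∉-++⁺ : ∀ {A : Set} {x : A} xs {ys} → x ∉ xs → x ∉ ys → x ∉ xs ++ ys
∉-++⁺ xs x∉xs x∉ys p with ∈-++⁻ xs p
... | inj₁ q = x∉xs q
... | inj₂ q = x∉ys q

fresh : List ℕ → ℕ
fresh xs = suc (max 0 xs)

fresh∉ : ∀ xs → fresh xs ∉ xs
fresh∉ xs p = <-irrefl refl (All.lookup (xs≤max 0 xs) p)

≡ᵇ-refl : ∀ n → (n ≡ᵇ n) ≡ true
≡ᵇ-refl n = Equivalence.to T-≡ (≡⇒≡ᵇ n n refl)

≡ᵇ-true⇒≡ : ∀ m n → (m ≡ᵇ n) ≡ true → m ≡ n
≡ᵇ-true⇒≡ m n e = ≡ᵇ⇒≡ m n (Equivalence.from T-≡ e)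

≢⇒≡ᵇ-false : ∀ {m n} → m ≢ n → (m ≡ᵇ n) ≡ false
≢⇒≡ᵇ-false {m} {n} m≢n with m ≡ᵇ n in e
... | true = ⊥-elim (m≢n (≡ᵇ-true⇒≡ m n e))
... | false = refl

≡ᵇ-false⇒≢ : ∀ {m n} → (m ≡ᵇ n) ≡ false → m ≢ n
≡ᵇ-false⇒≢ {m} e refl with () ← trans (sym (≡ᵇ-refl m)) e

subst₃ : ∀ {A B C : Set} (P : A → B → C → Set) {a a' b b' c c'} →
         a ≡ a' → b ≡ b' → c ≡ c' → P a b c → P a' b' c'
subst₃ P refl refl refl p = p

∈⇒∈-dom : ∀ {x M α} θ → (x , M , α) ∈ θ → x ∈ dom θ
∈⇒∈-dom θ = ∈-map⁺ proj₁

∈-dom⇒∈ : ∀ {x} θ → x ∈ dom θ → Σ Can λ M → Σ Arity λ α → (x , M , α) ∈ θ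
∈-dom⇒∈ θ p with ∈-map⁻ proj₁ p
... | (_ , M , α) , q , refl = M , α , q

IsSubst-functional : ∀ {x M N α β} θ → IsSubst θ →
                     (x , M , α) ∈ θ → (x , N , β) ∈ θ → M ≡ N × α ≡ β
IsSubst-functional (t ∷ θ) u         (here refl) (here refl) = refl , refl
IsSubst-functional (t ∷ θ) u         (here refl) (there q)   = ⊥-elim (Unique[x∷xs]⇒x∉xs u (∈⇒∈-dom θ q))
IsSubst-functional (t ∷ θ) u         (there p)   (here refl) = ⊥-elim (Unique[x∷xs]⇒x∉xs u (∈⇒∈-dom θ p))
IsSubst-functional (t ∷ θ) (_ ∷ u)   (there p)   (there q)   = IsSubst-functional θ u p q

fvsRng : Subst → List Name
fvsRng [] = []
fvsRng ((x , M , α) ∷ θ) = fvsC M ++ fvsRng θ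

∈-fvsRng : ∀ {x M α z} θ → (x , M , α) ∈ θ → z ∈ fvsC M → z ∈ fvsRng θ
∈-fvsRng ((y , N , β) ∷ θ) (here refl) q = ∈-++⁺ˡ q
∈-fvsRng ((y , N , β) ∷ θ) (there p)   q = ∈-++⁺ʳ (fvsC N) (∈-fvsRng θ p q)

∉-fvsRng⇒FreshRng : ∀ {z} θ → z ∉ fvsRng θ → FreshRng z θ
∉-fvsRng⇒FreshRng [] _ = []
∉-fvsRng⇒FreshRng ((y , N , β) ∷ θ) z∉ =
  ∉-++⁻ˡ (fvsRng θ) z∉ ∷ ∉-fvsRng⇒FreshRng θ (∉-++⁻ʳ (fvsC N) z∉)

FreshRng⇒∉-fvsRng : ∀ {z} θ → FreshRng z θ → z ∉ fvsRng θ
FreshRng⇒∉-fvsRng [] [] ()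
FreshRng⇒∉-fvsRng ((y , N , β) ∷ θ) (z∉N ∷ fr) = ∉-++⁺ (fvsC N) z∉N (FreshRng⇒∉-fvsRng θ fr)

aritySize : Arity → ℕ
aritySize o = 0
aritySize (α ⟶ β) = suc (aritySize α + aritySize β)

AritiesBelow : ℕ → Subst → Set
AritiesBelow b θ = ∀ {x M α} → (x , M , α) ∈ θ → aritySize α ≤ b

swapName : Name → Name → Name → Name
swapName a b x = if x ≡ᵇ a then b else (if x ≡ᵇ b then a else x)

swapName-left : ∀ a b → swapName a b a ≡ b
swapName-left a b rewrite ≡ᵇ-refl a = refl

swapName-right : ∀ a b → swapName a b b ≡ a
swapName-right a b with b ≡ᵇ a in e
... | true = ≡ᵇ-true⇒≡ b a e
... | false rewrite ≡ᵇ-refl b = refl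

swapName-other : ∀ {a b x} → x ≢ a → x ≢ b → swapName a b x ≡ x
swapName-other x≢a x≢b rewrite ≢⇒≡ᵇ-false x≢a | ≢⇒≡ᵇ-false x≢b = refl

swapName-involutive : ∀ a b x → swapName a b (swapName a b x) ≡ x
swapName-involutive a b x with x ≟ a | x ≟ b
... | yes refl | _      = trans (cong (swapName x b) (swapName-left x b)) (swapName-right x b)
... | no x≢a   | yes refl = trans (cong (swapName a x) (swapName-right a x)) (swapName-left a x)
... | no x≢a   | no x≢b =
  trans (cong (swapName a b) (swapName-other x≢a x≢b)) (swapName-other x≢a x≢b)

swapName-injective : ∀ a b {x y} → swapName a b x ≡ swapName a b y → x ≡ y
swapName-injective a b {x} {y} e =
  trans (sym (swapName-involutive a b x)) (trans (cong (swapName a b) e) (swapName-involutive a b y))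

mutual
  swapC : Name → Name → Can → Can
  swapC a b (atm R) = atm (swapA a b R)
  swapC a b (lam M) = lam (swapC a b M)

  swapA : Name → Name → Atm → Atm
  swapA a b (con c) = con c
  swapA a b (fv x) = fv (swapName a b x)
  swapA a b (bv i) = bv i
  swapA a b (app R M) = app (swapA a b R) (swapC a b M)

swapP : Name → Name → ATy → ATy
swapP a b (tcon c) = tcon c
swapP a b (tapp P M) = tapp (swapP a b P) (swapC a b M)

swapT : Name → Name → Ty → Ty
swapT a b (atyp P) = atyp (swapP a b P)
swapT a b (pi A B) = pi (swapT a b A) (swapT a b B)

swapK : Name → Name → Kind → Kind
swapK a b type = type
swapK a b (piK A K) = piK (swapT a b A) (swapK a b K)

mutual
  swap-openC : ∀ a b k x M → swapC a b (openC k x M) ≡ openC k (swapName a b x) (swapC a b M)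
  swap-openC a b k x (atm R) = cong atm (swap-openA a b k x R)
  swap-openC a b k x (lam M) = cong lam (swap-openC a b (suc k) x M)

  swap-openA : ∀ a b k x R → swapA a b (openA k x R) ≡ openA k (swapName a b x) (swapA a b R)
  swap-openA a b k x (con c) = refl
  swap-openA a b k x (fv y) = refl
  swap-openA a b k x (bv i) with i ≡ᵇ k
  ... | true = refl
  ... | false = refl
  swap-openA a b k x (app R M) = cong₂ app (swap-openA a b k x R) (swap-openC a b k x M)

swap-openP : ∀ a b k x P → swapP a b (openP k x P) ≡ openP k (swapName a b x) (swapP a b P)
swap-openP a b k x (tcon c) = refl
swap-openP a b k x (tapp P M) = cong₂ tapp (swap-openP a b k x P) (swap-openC a b k x M)

swap-openT : ∀ a b k x A → swapT a b (openT k x A) ≡ openT k (swapName a b x) (swapT a b A)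
swap-openT a b k x (atyp P) = cong atyp (swap-openP a b k x P)
swap-openT a b k x (pi A B) = cong₂ pi (swap-openT a b k x A) (swap-openT a b (suc k) x B)

swap-openK : ∀ a b k x K → swapK a b (openK k x K) ≡ openK k (swapName a b x) (swapK a b K)
swap-openK a b k x type = refl
swap-openK a b k x (piK A K) = cong₂ piK (swap-openT a b k x A) (swap-openK a b (suc k) x K)

mutual
  swapC-fresh : ∀ {a b} M → a ∉ fvsC M → b ∉ fvsC M → swapC a b M ≡ M
  swapC-fresh (atm R) a∉ b∉ = cong atm (swapA-fresh R a∉ b∉)
  swapC-fresh (lam M) a∉ b∉ = cong lam (swapC-fresh M a∉ b∉)

  swapA-fresh : ∀ {a b} R → a ∉ fvsA R → b ∉ fvsA R → swapA a b R ≡ R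
  swapA-fresh (con c) a∉ b∉ = refl
  swapA-fresh (fv y) a∉ b∉ = cong fv (swapName-other (λ e → a∉ (here (sym e))) (λ e → b∉ (here (sym e))))
  swapA-fresh (bv i) a∉ b∉ = refl
  swapA-fresh (app R M) a∉ b∉ =
    cong₂ app (swapA-fresh R (∉-++⁻ˡ (fvsC M) a∉) (∉-++⁻ˡ (fvsC M) b∉))
              (swapC-fresh M (∉-++⁻ʳ (fvsA R) a∉) (∉-++⁻ʳ (fvsA R) b∉))

swapP-fresh : ∀ {a b} P → a ∉ fvsP P → b ∉ fvsP P → swapP a b P ≡ P
swapP-fresh (tcon c) a∉ b∉ = refl
swapP-fresh (tapp P M) a∉ b∉ =
  cong₂ tapp (swapP-fresh P (∉-++⁻ˡ (fvsC M) a∉) (∉-++⁻ˡ (fvsC M) b∉))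
             (swapC-fresh M (∉-++⁻ʳ (fvsP P) a∉) (∉-++⁻ʳ (fvsP P) b∉))

swapT-fresh : ∀ {a b} A → a ∉ fvsT A → b ∉ fvsT A → swapT a b A ≡ A
swapT-fresh (atyp P) a∉ b∉ = cong atyp (swapP-fresh P a∉ b∉)
swapT-fresh (pi A B) a∉ b∉ =
  cong₂ pi (swapT-fresh A (∉-++⁻ˡ (fvsT B) a∉) (∉-++⁻ˡ (fvsT B) b∉))
           (swapT-fresh B (∉-++⁻ʳ (fvsT A) a∉) (∉-++⁻ʳ (fvsT A) b∉))

swapK-fresh : ∀ {a b} K → a ∉ fvsK K → b ∉ fvsK K → swapK a b K ≡ K
swapK-fresh type a∉ b∉ = refl
swapK-fresh (piK A K) a∉ b∉ =
  cong₂ piK (swapT-fresh A (∉-++⁻ˡ (fvsK K) a∉) (∉-++⁻ˡ (fvsK K) b∉))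
            (swapK-fresh K (∉-++⁻ʳ (fvsT A) a∉) (∉-++⁻ʳ (fvsT A) b∉))

fvs-++ : ∀ {y z : Name} xs' {ys' xs ys} →
         (y ∈ xs' → y ≡ z ⊎ y ∈ xs) → (y ∈ ys' → y ≡ z ⊎ y ∈ ys) →
         y ∈ xs' ++ ys' → y ≡ z ⊎ y ∈ xs ++ ys
fvs-++ xs' f g p with ∈-++⁻ xs' p
... | inj₁ q = Sum.map₂ ∈-++⁺ˡ (f q)
... | inj₂ q = Sum.map₂ (∈-++⁺ʳ _) (g q)

mutual
  fvs-openC : ∀ {y} k z M → y ∈ fvsC (openC k z M) → y ≡ z ⊎ y ∈ fvsC M
  fvs-openC k z (atm R) = fvs-openA k z R
  fvs-openC k z (lam M) = fvs-openC (suc k) z M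

  fvs-openA : ∀ {y} k z R → y ∈ fvsA (openA k z R) → y ≡ z ⊎ y ∈ fvsA R
  fvs-openA k z (con c) ()
  fvs-openA k z (fv x) p = inj₂ p
  fvs-openA k z (bv i) p with i ≡ᵇ k
  fvs-openA k z (bv i) (here refl) | true = inj₁ refl
  fvs-openA k z (bv i) ()          | false
  fvs-openA k z (app R M) = fvs-++ (fvsA (openA k z R)) (fvs-openA k z R) (fvs-openC k z M)

fvs-openP : ∀ {y} k z P → y ∈ fvsP (openP k z P) → y ≡ z ⊎ y ∈ fvsP P
fvs-openP k z (tcon c) ()
fvs-openP k z (tapp P M) = fvs-++ (fvsP (openP k z P)) (fvs-openP k z P) (fvs-openC k z M)

fvs-openT : ∀ {y} k z A → y ∈ fvsT (openT k z A) → y ≡ z ⊎ y ∈ fvsT A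
fvs-openT k z (atyp P) = fvs-openP k z P
fvs-openT k z (pi A B) = fvs-++ (fvsT (openT k z A)) (fvs-openT k z A) (fvs-openT (suc k) z B)

fvs-openK : ∀ {y} k z K → y ∈ fvsK (openK k z K) → y ≡ z ⊎ y ∈ fvsK K
fvs-openK k z type ()
fvs-openK k z (piK A K) = fvs-++ (fvsT (openT k z A)) (fvs-openT k z A) (fvs-openK (suc k) z K)

∉-openC : ∀ {y} k z M → y ≢ z → y ∉ fvsC M → y ∉ fvsC (openC k z M)
∉-openC k z M y≢z y∉ p = Sum.[ y≢z , y∉ ] (fvs-openC k z M p)

mutual
  fvs-closeC : ∀ {y} k x N → y ∈ fvsC (closeC k x N) → y ∈ fvsC N × y ≢ x
  fvs-closeC k x (atm R) = fvs-closeA k x R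
  fvs-closeC k x (lam N) = fvs-closeC (suc k) x N

  fvs-closeA : ∀ {y} k x R → y ∈ fvsA (closeA k x R) → y ∈ fvsA R × y ≢ x
  fvs-closeA k x (con c) ()
  fvs-closeA k x (fv z) p with z ≡ᵇ x in e
  fvs-closeA k x (fv z) ()          | true
  fvs-closeA k x (fv z) (here refl) | false = here refl , ≡ᵇ-false⇒≢ e
  fvs-closeA k x (bv i) ()
  fvs-closeA k x (app R M) p with ∈-++⁻ (fvsA (closeA k x R)) p
  ... | inj₁ q = Product.map₁ ∈-++⁺ˡ (fvs-closeA k x R q)
  ... | inj₂ q = Product.map₁ (∈-++⁺ʳ (fvsA R)) (fvs-closeC k x M q)

mutual
  lcC : ℕ → Can → Set
  lcC k (atm R) = lcA k R
  lcC k (lam M) = lcC (suc k) M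

  lcA : ℕ → Atm → Set
  lcA k (con c) = ⊤
  lcA k (fv x) = ⊤
  lcA k (bv i) = i < k
  lcA k (app R M) = lcA k R × lcC k M

lcP : ℕ → ATy → Set
lcP k (tcon a) = ⊤
lcP k (tapp P M) = lcP k P × lcC k M

lcT : ℕ → Ty → Set
lcT k (atyp P) = lcP k P
lcT k (pi A B) = lcT k A × lcT (suc k) B

lcK : ℕ → Kind → Set
lcK k type = ⊤
lcK k (piK A K) = lcT k A × lcK (suc k) K

mutual
  lc-openC : ∀ k x M → lcC (suc k) M → lcC k (openC k x M)
  lc-openC k x (atm R) = lc-openA k x R
  lc-openC k x (lam M) = lc-openC (suc k) x M

  lc-openA : ∀ k x R → lcA (suc k) R → lcA k (openA k x R)
  lc-openA k x (con c) _ = tt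
  lc-openA k x (fv y) _ = tt
  lc-openA k x (bv i) i<1+k with i ≡ᵇ k in e
  ... | true = tt
  ... | false = ≤∧≢⇒< (s≤s⁻¹ i<1+k) (≡ᵇ-false⇒≢ e)
  lc-openA k x (app R M) (lR , lM) = lc-openA k x R lR , lc-openC k x M lM

lc-openP : ∀ k x P → lcP (suc k) P → lcP k (openP k x P)
lc-openP k x (tcon a) _ = tt
lc-openP k x (tapp P M) (lP , lM) = lc-openP k x P lP , lc-openC k x M lM

lc-openT : ∀ k x A → lcT (suc k) A → lcT k (openT k x A)
lc-openT k x (atyp P) = lc-openP k x P
lc-openT k x (pi A B) (lA , lB) = lc-openT k x A lA , lc-openT (suc k) x B lB

lc-openK : ∀ k x K → lcK (suc k) K → lcK k (openK k x K)
lc-openK k x type _ = tt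
lc-openK k x (piK A K) (lA , lK) = lc-openT k x A lA , lc-openK (suc k) x K lK

mutual
  lc-openC⁻ : ∀ k x M → lcC k (openC k x M) → lcC (suc k) M
  lc-openC⁻ k x (atm R) = lc-openA⁻ k x R
  lc-openC⁻ k x (lam M) = lc-openC⁻ (suc k) x M

  lc-openA⁻ : ∀ k x R → lcA k (openA k x R) → lcA (suc k) R
  lc-openA⁻ k x (con c) _ = tt
  lc-openA⁻ k x (fv y) _ = tt
  lc-openA⁻ k x (bv i) l with i ≡ᵇ k in e
  ... | true rewrite ≡ᵇ-true⇒≡ i k e = ≤-refl
  ... | false = m≤n⇒m≤1+n l
  lc-openA⁻ k x (app R M) (lR , lM) = lc-openA⁻ k x R lR , lc-openC⁻ k x M lM

lc-openP⁻ : ∀ k x P → lcP k (openP k x P) → lcP (suc k) P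
lc-openP⁻ k x (tcon a) _ = tt
lc-openP⁻ k x (tapp P M) (lP , lM) = lc-openP⁻ k x P lP , lc-openC⁻ k x M lM

lc-openT⁻ : ∀ k x A → lcT k (openT k x A) → lcT (suc k) A
lc-openT⁻ k x (atyp P) = lc-openP⁻ k x P
lc-openT⁻ k x (pi A B) (lA , lB) = lc-openT⁻ k x A lA , lc-openT⁻ (suc k) x B lB

lc-openK⁻ : ∀ k x K → lcK k (openK k x K) → lcK (suc k) K
lc-openK⁻ k x type _ = tt
lc-openK⁻ k x (piK A K) (lA , lK) = lc-openT⁻ k x A lA , lc-openK⁻ (suc k) x K lK

mutual
  lc-closeC : ∀ k x N → lcC k N → lcC (suc k) (closeC k x N)
  lc-closeC k x (atm R) = lc-closeA k x R
  lc-closeC k x (lam N) = lc-closeC (suc k) x N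

  lc-closeA : ∀ k x R → lcA k R → lcA (suc k) (closeA k x R)
  lc-closeA k x (con c) _ = tt
  lc-closeA k x (fv y) _ with y ≡ᵇ x
  ... | true = ≤-refl
  ... | false = tt
  lc-closeA k x (bv i) i<k = m≤n⇒m≤1+n i<k
  lc-closeA k x (app R M) (lR , lM) = lc-closeA k x R lR , lc-closeC k x M lM

lc-closeP : ∀ k x P → lcP k P → lcP (suc k) (closeP k x P)
lc-closeP k x (tcon a) _ = tt
lc-closeP k x (tapp P M) (lP , lM) = lc-closeP k x P lP , lc-closeC k x M lM

lc-closeT : ∀ k x A → lcT k A → lcT (suc k) (closeT k x A)
lc-closeT k x (atyp P) = lc-closeP k x P
lc-closeT k x (pi A B) (lA , lB) = lc-closeT k x A lA , lc-closeT (suc k) x B lB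

lc-closeK : ∀ k x K → lcK k K → lcK (suc k) (closeK k x K)
lc-closeK k x type _ = tt
lc-closeK k x (piK A K) (lA , lK) = lc-closeT k x A lA , lc-closeK (suc k) x K lK

mutual
  close-openC : ∀ k z N → z ∉ fvsC N → closeC k z (openC k z N) ≡ N
  close-openC k z (atm R) z∉ = cong atm (close-openA k z R z∉)
  close-openC k z (lam N) z∉ = cong lam (close-openC (suc k) z N z∉)

  close-openA : ∀ k z R → z ∉ fvsA R → closeA k z (openA k z R) ≡ R
  close-openA k z (con c) _ = refl
  close-openA k z (fv y) z∉ rewrite ≢⇒≡ᵇ-false {y} {z} (λ e → z∉ (here (sym e))) = refl
  close-openA k z (bv i) _ with i ≡ᵇ k in e
  ... | true rewrite ≡ᵇ-refl z | ≡ᵇ-true⇒≡ i k e = refl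
  ... | false = refl
  close-openA k z (app R M) z∉ =
    cong₂ app (close-openA k z R (∉-++⁻ˡ (fvsC M) z∉)) (close-openC k z M (∉-++⁻ʳ (fvsA R) z∉))

close-openP : ∀ k z P → z ∉ fvsP P → closeP k z (openP k z P) ≡ P
close-openP k z (tcon a) _ = refl
close-openP k z (tapp P M) z∉ =
  cong₂ tapp (close-openP k z P (∉-++⁻ˡ (fvsC M) z∉)) (close-openC k z M (∉-++⁻ʳ (fvsP P) z∉))

close-openT : ∀ k z A → z ∉ fvsT A → closeT k z (openT k z A) ≡ A
close-openT k z (atyp P) z∉ = cong atyp (close-openP k z P z∉)
close-openT k z (pi A B) z∉ =
  cong₂ pi (close-openT k z A (∉-++⁻ˡ (fvsT B) z∉)) (close-openT (suc k) z B (∉-++⁻ʳ (fvsT A) z∉))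

close-openK : ∀ k z K → z ∉ fvsK K → closeK k z (openK k z K) ≡ K
close-openK k z type _ = refl
close-openK k z (piK A K) z∉ =
  cong₂ piK (close-openT k z A (∉-++⁻ˡ (fvsK K) z∉)) (close-openK (suc k) z K (∉-++⁻ʳ (fvsT A) z∉))

openC-injective : ∀ {k z} N₁ N₂ → z ∉ fvsC N₁ → z ∉ fvsC N₂ → openC k z N₁ ≡ openC k z N₂ → N₁ ≡ N₂
openC-injective {k} {z} N₁ N₂ z∉N₁ z∉N₂ e = begin
  N₁                           ≡⟨ close-openC k z N₁ z∉N₁ ⟨
  closeC k z (openC k z N₁)    ≡⟨ cong (closeC k z) e ⟩
  closeC k z (openC k z N₂)    ≡⟨ close-openC k z N₂ z∉N₂ ⟩
  N₂                           ∎
  where open ≡-Reasoning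

<⇒≡ᵇ-false : ∀ {i k} → i < k → (i ≡ᵇ k) ≡ false
<⇒≡ᵇ-false i<k = ≢⇒≡ᵇ-false (λ e → <-irrefl e i<k)

mutual
  open-closeC : ∀ k x z N → lcC k N → z ∉ fvsC N → openC k z (closeC k x N) ≡ swapC x z N
  open-closeC k x z (atm R) l z∉ = cong atm (open-closeA k x z R l z∉)
  open-closeC k x z (lam N) l z∉ = cong lam (open-closeC (suc k) x z N l z∉)

  open-closeA : ∀ k x z R → lcA k R → z ∉ fvsA R → openA k z (closeA k x R) ≡ swapA x z R
  open-closeA k x z (con c) _ _ = refl
  open-closeA k x z (fv y) _ z∉ with y ≡ᵇ x in e
  ... | true rewrite ≡ᵇ-refl k | ≡ᵇ-true⇒≡ y x e = refl
  ... | false rewrite ≢⇒≡ᵇ-false {y} {z} (λ q → z∉ (here (sym q))) = refl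
  open-closeA k x z (bv i) i<k _ rewrite <⇒≡ᵇ-false i<k = refl
  open-closeA k x z (app R M) (lR , lM) z∉ =
    cong₂ app (open-closeA k x z R lR (∉-++⁻ˡ (fvsC M) z∉)) (open-closeC k x z M lM (∉-++⁻ʳ (fvsA R) z∉))

open-closeP : ∀ k x z P → lcP k P → z ∉ fvsP P → openP k z (closeP k x P) ≡ swapP x z P
open-closeP k x z (tcon a) _ _ = refl
open-closeP k x z (tapp P M) (lP , lM) z∉ =
  cong₂ tapp (open-closeP k x z P lP (∉-++⁻ˡ (fvsC M) z∉)) (open-closeC k x z M lM (∉-++⁻ʳ (fvsP P) z∉))

open-closeT : ∀ k x z A → lcT k A → z ∉ fvsT A → openT k z (closeT k x A) ≡ swapT x z A
open-closeT k x z (atyp P) l z∉ = cong atyp (open-closeP k x z P l z∉)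
open-closeT k x z (pi A B) (lA , lB) z∉ =
  cong₂ pi (open-closeT k x z A lA (∉-++⁻ˡ (fvsT B) z∉)) (open-closeT (suc k) x z B lB (∉-++⁻ʳ (fvsT A) z∉))

open-closeK : ∀ k x z K → lcK k K → z ∉ fvsK K → openK k z (closeK k x K) ≡ swapK x z K
open-closeK k x z type _ _ = refl
open-closeK k x z (piK A K) (lA , lK) z∉ =
  cong₂ piK (open-closeT k x z A lA (∉-++⁻ˡ (fvsK K) z∉)) (open-closeK (suc k) x z K lK (∉-++⁻ʳ (fvsT A) z∉))

renameName : Name → Name → Name → Name
renameName x w y = if y ≡ᵇ x then w else y

mutual
  renameC : Name → Name → Can → Can
  renameC x w (atm R) = atm (renameA x w R)
  renameC x w (lam M) = lam (renameC x w M)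

  renameA : Name → Name → Atm → Atm
  renameA x w (con c) = con c
  renameA x w (fv y) = fv (renameName x w y)
  renameA x w (bv i) = bv i
  renameA x w (app R M) = app (renameA x w R) (renameC x w M)

mutual
  renameC-openC : ∀ x w k z M → z ≢ x → renameC x w (openC k z M) ≡ openC k z (renameC x w M)
  renameC-openC x w k z (atm R) z≢x = cong atm (renameA-openA x w k z R z≢x)
  renameC-openC x w k z (lam M) z≢x = cong lam (renameC-openC x w (suc k) z M z≢x)

  renameA-openA : ∀ x w k z R → z ≢ x → renameA x w (openA k z R) ≡ openA k z (renameA x w R)
  renameA-openA x w k z (con c) _ = refl
  renameA-openA x w k z (fv y) _ = refl
  renameA-openA x w k z (bv i) z≢x with i ≡ᵇ k
  ... | true rewrite ≢⇒≡ᵇ-false z≢x = refl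
  ... | false = refl
  renameA-openA x w k z (app R M) z≢x =
    cong₂ app (renameA-openA x w k z R z≢x) (renameC-openC x w k z M z≢x)

mutual
  renameC-openC-self : ∀ x w k M → x ∉ fvsC M → renameC x w (openC k x M) ≡ openC k w M
  renameC-openC-self x w k (atm R) x∉ = cong atm (renameA-openA-self x w k R x∉)
  renameC-openC-self x w k (lam M) x∉ = cong lam (renameC-openC-self x w (suc k) M x∉)

  renameA-openA-self : ∀ x w k R → x ∉ fvsA R → renameA x w (openA k x R) ≡ openA k w R
  renameA-openA-self x w k (con c) _ = refl
  renameA-openA-self x w k (fv y) x∉ rewrite ≢⇒≡ᵇ-false {y} {x} (λ e → x∉ (here (sym e))) = refl
  renameA-openA-self x w k (bv i) _ with i ≡ᵇ k
  ... | true rewrite ≡ᵇ-refl x = refl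
  ... | false = refl
  renameA-openA-self x w k (app R M) x∉ =
    cong₂ app (renameA-openA-self x w k R (∉-++⁻ˡ (fvsC M) x∉)) (renameC-openC-self x w k M (∉-++⁻ʳ (fvsA R) x∉))

mutual
  sizeC : Can → ℕ
  sizeC (atm R) = sizeA R
  sizeC (lam M) = suc (sizeC M)

  sizeA : Atm → ℕ
  sizeA (con c) = 0
  sizeA (fv x) = 0
  sizeA (bv i) = 0
  sizeA (app R M) = suc (sizeA R + sizeC M)

mutual
  size-openC : ∀ k z M → sizeC (openC k z M) ≡ sizeC M
  size-openC k z (atm R) = size-openA k z R
  size-openC k z (lam M) = cong suc (size-openC (suc k) z M)

  size-openA : ∀ k z R → sizeA (openA k z R) ≡ sizeA R
  size-openA k z (con c) = refl
  size-openA k z (fv y) = refl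
  size-openA k z (bv i) with i ≡ᵇ k
  ... | true = refl
  ... | false = refl
  size-openA k z (app R M) = cong suc (cong₂ _+_ (size-openA k z R) (size-openC k z M))

-- Being equivariant (swap-SubCᶜ), they
-- support induction; on locally closed terms they agree with those of Defs.
mutual
  data SubCᶜ (θ : Subst) : Can → Can → Set where
    sc-atm : ∀ {R R'} → SubRᶜ θ R R' → SubCᶜ θ (atm R) (atm R')
    sc-can : ∀ {R M α} → SubRCᶜ θ R M α → SubCᶜ θ (atm R) M
    sc-lam : ∀ {M N} (L : List Name) → (∀ z → z ∉ L → SubCᶜ θ (openC 0 z M) (openC 0 z N)) →
             SubCᶜ θ (lam M) (lam N)

  data SubRCᶜ (θ : Subst) : Atm → Can → Arity → Set where
    src-var : ∀ {x M α} → (x , M , α) ∈ θ → SubRCᶜ θ (fv x) M α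
    src-app : ∀ {R M M₁ M'' M''' α' α''} →
              SubRCᶜ θ R (lam M₁) (α' ⟶ α'') → SubCᶜ θ M M'' → (L : List Name) →
              (∀ x → x ∉ L → SubCᶜ ((x , M'' , α') ∷ []) (openC 0 x M₁) M''') →
              SubRCᶜ θ (app R M) M''' α''

  data SubRᶜ (θ : Subst) : Atm → Atm → Set where
    sr-con : ∀ {c} → SubRᶜ θ (con c) (con c)
    sr-var : ∀ {x} → x ∉ dom θ → SubRᶜ θ (fv x) (fv x)
    sr-app : ∀ {R R' M M'} → SubRᶜ θ R R' → SubCᶜ θ M M' → SubRᶜ θ (app R M) (app R' M')

data SubPᶜ (θ : Subst) : ATy → ATy → Set where
  sp-con : ∀ {a} → SubPᶜ θ (tcon a) (tcon a)
  sp-app : ∀ {P P' M M'} → SubPᶜ θ P P' → SubCᶜ θ M M' → SubPᶜ θ (tapp P M) (tapp P' M')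

data SubTᶜ (θ : Subst) : Ty → Ty → Set where
  st-atm : ∀ {P P'} → SubPᶜ θ P P' → SubTᶜ θ (atyp P) (atyp P')
  st-pi  : ∀ {A₁ A₁' A₂ A₂'} → SubTᶜ θ A₁ A₁' → (L : List Name) →
           (∀ z → z ∉ L → SubTᶜ θ (openT 0 z A₂) (openT 0 z A₂')) → SubTᶜ θ (pi A₁ A₂) (pi A₁' A₂')

data SubKᶜ (θ : Subst) : Kind → Kind → Set where
  sk-type : SubKᶜ θ type type
  sk-pi   : ∀ {A A' K K'} → SubTᶜ θ A A' → (L : List Name) →
            (∀ z → z ∉ L → SubKᶜ θ (openK 0 z K) (openK 0 z K')) → SubKᶜ θ (piK A K) (piK A' K')

single : Name → Can → Arity → Subst
single x N α = (x , N , α) ∷ []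

swapSubst : Name → Name → Subst → Subst
swapSubst a b = map (λ (x , M , α) → swapName a b x , swapC a b M , α)

∉-dom-swapSubst : ∀ a b {x} θ → x ∉ dom θ → swapName a b x ∉ dom (swapSubst a b θ)
∉-dom-swapSubst a b (t ∷ θ) x∉ (here e) = x∉ (here (swapName-injective a b e))
∉-dom-swapSubst a b (t ∷ θ) x∉ (there p) = ∉-dom-swapSubst a b θ (λ q → x∉ (there q)) p

swapSubst-fresh : ∀ a b θ → a ∉ dom θ → b ∉ dom θ → a ∉ fvsRng θ → b ∉ fvsRng θ → swapSubst a b θ ≡ θ
swapSubst-fresh a b [] _ _ _ _ = refl
swapSubst-fresh a b ((x , M , α) ∷ θ) a∉dom b∉dom a∉rng b∉rng =
  cong₂ _∷_
    (cong₂ _,_ (swapName-other (λ e → a∉dom (here (sym e))) (λ e → b∉dom (here (sym e))))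
               (cong (_, α) (swapC-fresh M (∉-++⁻ˡ (fvsRng θ) a∉rng) (∉-++⁻ˡ (fvsRng θ) b∉rng))))
    (swapSubst-fresh a b θ (λ p → a∉dom (there p)) (λ p → b∉dom (there p))
                           (∉-++⁻ʳ (fvsC M) a∉rng) (∉-++⁻ʳ (fvsC M) b∉rng))

∉-map-swapName : ∀ a b {z} L → z ∉ map (swapName a b) L → swapName a b z ∉ L
∉-map-swapName a b {z} L z∉ p =
  z∉ (subst (_∈ map (swapName a b) L) (swapName-involutive a b z) (∈-map⁺ (swapName a b) p))

swap-openC-swapped : ∀ a b z M → swapC a b (openC 0 (swapName a b z) M) ≡ openC 0 z (swapC a b M)
swap-openC-swapped a b z M =
  trans (swap-openC a b 0 (swapName a b z) M) (cong (λ y → openC 0 y (swapC a b M)) (swapName-involutive a b z))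

swap-openT-swapped : ∀ a b z A → swapT a b (openT 0 (swapName a b z) A) ≡ openT 0 z (swapT a b A)
swap-openT-swapped a b z A =
  trans (swap-openT a b 0 (swapName a b z) A) (cong (λ y → openT 0 y (swapT a b A)) (swapName-involutive a b z))

swap-openK-swapped : ∀ a b z K → swapK a b (openK 0 (swapName a b z) K) ≡ openK 0 z (swapK a b K)
swap-openK-swapped a b z K =
  trans (swap-openK a b 0 (swapName a b z) K) (cong (λ y → openK 0 y (swapK a b K)) (swapName-involutive a b z))

mutual
  swap-SubCᶜ : ∀ a b {θ M N} → SubCᶜ θ M N → SubCᶜ (swapSubst a b θ) (swapC a b M) (swapC a b N)
  swap-SubCᶜ a b (sc-atm d) = sc-atm (swap-SubRᶜ a b d)
  swap-SubCᶜ a b (sc-can d) = sc-can (swap-SubRCᶜ a b d)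
  swap-SubCᶜ a b {θ} (sc-lam {M} {N} L f) = sc-lam (map (swapName a b) L) λ z z∉ →
    subst₂ (SubCᶜ (swapSubst a b θ)) (swap-openC-swapped a b z M) (swap-openC-swapped a b z N)
           (swap-SubCᶜ a b (f (swapName a b z) (∉-map-swapName a b L z∉)))

  swap-SubRCᶜ : ∀ a b {θ R M α} → SubRCᶜ θ R M α → SubRCᶜ (swapSubst a b θ) (swapA a b R) (swapC a b M) α
  swap-SubRCᶜ a b (src-var p) = src-var (∈-map⁺ _ p)
  swap-SubRCᶜ a b (src-app {M₁ = M₁} {M'' = M''} {M''' = M'''} {α' = α'} h d L f) =
    src-app (swap-SubRCᶜ a b h) (swap-SubCᶜ a b d) (map (swapName a b) L) λ x x∉ →
      subst (λ y → SubCᶜ (single y (swapC a b M'') α') (openC 0 x (swapC a b M₁)) (swapC a b M'''))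
            (swapName-involutive a b x)
            (subst (λ t → SubCᶜ _ t (swapC a b M''')) (swap-openC-swapped a b x M₁)
                   (swap-SubCᶜ a b (f (swapName a b x) (∉-map-swapName a b L x∉))))

  swap-SubRᶜ : ∀ a b {θ R R'} → SubRᶜ θ R R' → SubRᶜ (swapSubst a b θ) (swapA a b R) (swapA a b R')
  swap-SubRᶜ a b sr-con = sr-con
  swap-SubRᶜ a b {θ} (sr-var x∉) = sr-var (∉-dom-swapSubst a b θ x∉)
  swap-SubRᶜ a b (sr-app d e) = sr-app (swap-SubRᶜ a b d) (swap-SubCᶜ a b e)

swap-SubPᶜ : ∀ a b {θ P P'} → SubPᶜ θ P P' → SubPᶜ (swapSubst a b θ) (swapP a b P) (swapP a b P')
swap-SubPᶜ a b sp-con = sp-con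
swap-SubPᶜ a b (sp-app d e) = sp-app (swap-SubPᶜ a b d) (swap-SubCᶜ a b e)

swap-SubTᶜ : ∀ a b {θ A A'} → SubTᶜ θ A A' → SubTᶜ (swapSubst a b θ) (swapT a b A) (swapT a b A')
swap-SubTᶜ a b (st-atm d) = st-atm (swap-SubPᶜ a b d)
swap-SubTᶜ a b {θ} (st-pi {A₂ = A₂} {A₂' = A₂'} d L f) =
  st-pi (swap-SubTᶜ a b d) (map (swapName a b) L) λ z z∉ →
    subst₂ (SubTᶜ (swapSubst a b θ)) (swap-openT-swapped a b z A₂) (swap-openT-swapped a b z A₂')
           (swap-SubTᶜ a b (f (swapName a b z) (∉-map-swapName a b L z∉)))

swap-SubKᶜ : ∀ a b {θ K K'} → SubKᶜ θ K K' → SubKᶜ (swapSubst a b θ) (swapK a b K) (swapK a b K')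
swap-SubKᶜ a b sk-type = sk-type
swap-SubKᶜ a b {θ} (sk-pi {K = K} {K' = K'} d L f) =
  sk-pi (swap-SubTᶜ a b d) (map (swapName a b) L) λ z z∉ →
    subst₂ (SubKᶜ (swapSubst a b θ)) (swap-openK-swapped a b z K) (swap-openK-swapped a b z K')
           (swap-SubKᶜ a b (f (swapName a b z) (∉-map-swapName a b L z∉)))

-- Renaming rather than swapping: the substituted term N may mention x and must stay fixed.
mutual
  rename-SubCᶜ : ∀ {x w N α M R} → SubCᶜ (single x N α) M R → w ∉ fvsC M →
                 SubCᶜ (single w N α) (renameC x w M) R
  rename-SubCᶜ (sc-atm d) w∉ = sc-atm (rename-SubRᶜ d w∉)
  rename-SubCᶜ (sc-can d) w∉ = sc-can (rename-SubRCᶜ d w∉)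
  rename-SubCᶜ {x} {w} (sc-lam {M} L f) w∉ = sc-lam (x ∷ w ∷ L) λ z z∉ →
    subst (λ t → SubCᶜ _ t _) (renameC-openC x w 0 z M (λ e → z∉ (here e)))
      (rename-SubCᶜ (f z (λ p → z∉ (there (there p)))) (∉-openC 0 z M (λ e → z∉ (there (here (sym e)))) w∉))

  rename-SubRCᶜ : ∀ {x w N α R M β} → SubRCᶜ (single x N α) R M β → w ∉ fvsA R →
                  SubRCᶜ (single w N α) (renameA x w R) M β
  rename-SubRCᶜ {x} (src-var (here refl)) _ rewrite ≡ᵇ-refl x = src-var (here refl)
  rename-SubRCᶜ (src-app h d L f) w∉ =
    src-app (rename-SubRCᶜ h (∉-++⁻ˡ _ w∉)) (rename-SubCᶜ d (∉-++⁻ʳ _ w∉)) L f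

  rename-SubRᶜ : ∀ {x w N α R R'} → SubRᶜ (single x N α) R R' → w ∉ fvsA R →
                 SubRᶜ (single w N α) (renameA x w R) R'
  rename-SubRᶜ sr-con _ = sr-con
  rename-SubRᶜ {x} (sr-var {y} y∉) w∉ rewrite ≢⇒≡ᵇ-false {y} {x} (λ e → y∉ (here e)) =
    sr-var λ { (here e) → w∉ (here (sym e)) }
  rename-SubRᶜ (sr-app d e) w∉ = sr-app (rename-SubRᶜ d (∉-++⁻ˡ _ w∉)) (rename-SubCᶜ e (∉-++⁻ʳ _ w∉))

SubCᶜ-single-rename : ∀ {x N α M₁ M'''} → SubCᶜ (single x N α) (openC 0 x M₁) M''' → x ∉ fvsC M₁ →
                      ∀ y → y ∉ x ∷ fvsC M₁ → SubCᶜ (single y N α) (openC 0 y M₁) M'''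
SubCᶜ-single-rename {x} {M₁ = M₁} d x∉ y y∉ =
  subst (λ t → SubCᶜ _ t _) (renameC-openC-self x y 0 M₁ x∉)
    (rename-SubCᶜ d (∉-openC 0 x M₁ (λ e → y∉ (here e)) (λ p → y∉ (there p))))

-- A binder premise proved for one fresh name z holds for every name y fresh for
-- everything in sight: swap z and y.
SubCᶜ-reopen : ∀ {θ z M N} → SubCᶜ θ (openC 0 z M) N →
               z ∉ dom θ → z ∉ fvsRng θ → z ∉ fvsC M → lcC 0 N →
               ∀ y → y ∉ dom θ ++ fvsRng θ ++ fvsC M ++ fvsC N →
               SubCᶜ θ (openC 0 y M) (openC 0 y (closeC 0 z N))
SubCᶜ-reopen {θ} {z} {M} {N} d z∉dom z∉rng z∉M lN y y∉ =
  let y∉dom , y∉₁ = ∉-++⁻ (dom θ) y∉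
      y∉rng , y∉₂ = ∉-++⁻ (fvsRng θ) y∉₁
      y∉M , y∉N = ∉-++⁻ (fvsC M) y∉₂
  in subst₃ SubCᶜ (swapSubst-fresh z y θ z∉dom y∉dom z∉rng y∉rng)
       (trans (swap-openC z y 0 z M) (cong₂ (openC 0) (swapName-left z y) (swapC-fresh M z∉M y∉M)))
       (sym (open-closeC 0 z y N lN y∉N))
       (swap-SubCᶜ z y d)

SubTᶜ-reopen : ∀ {θ z A A'} → SubTᶜ θ (openT 0 z A) A' →
               z ∉ dom θ → z ∉ fvsRng θ → z ∉ fvsT A → lcT 0 A' →
               ∀ y → y ∉ dom θ ++ fvsRng θ ++ fvsT A ++ fvsT A' →
               SubTᶜ θ (openT 0 y A) (openT 0 y (closeT 0 z A'))
SubTᶜ-reopen {θ} {z} {A} {A'} d z∉dom z∉rng z∉A lA' y y∉ =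
  let y∉dom , y∉₁ = ∉-++⁻ (dom θ) y∉
      y∉rng , y∉₂ = ∉-++⁻ (fvsRng θ) y∉₁
      y∉A , y∉A' = ∉-++⁻ (fvsT A) y∉₂
  in subst₃ SubTᶜ (swapSubst-fresh z y θ z∉dom y∉dom z∉rng y∉rng)
       (trans (swap-openT z y 0 z A) (cong₂ (openT 0) (swapName-left z y) (swapT-fresh A z∉A y∉A)))
       (sym (open-closeT 0 z y A' lA' y∉A'))
       (swap-SubTᶜ z y d)

SubKᶜ-reopen : ∀ {θ z K K'} → SubKᶜ θ (openK 0 z K) K' →
               z ∉ dom θ → z ∉ fvsRng θ → z ∉ fvsK K → lcK 0 K' →
               ∀ y → y ∉ dom θ ++ fvsRng θ ++ fvsK K ++ fvsK K' →
               SubKᶜ θ (openK 0 y K) (openK 0 y (closeK 0 z K'))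
SubKᶜ-reopen {θ} {z} {K} {K'} d z∉dom z∉rng z∉K lK' y y∉ =
  let y∉dom , y∉₁ = ∉-++⁻ (dom θ) y∉
      y∉rng , y∉₂ = ∉-++⁻ (fvsRng θ) y∉₁
      y∉K , y∉K' = ∉-++⁻ (fvsK K) y∉₂
  in subst₃ SubKᶜ (swapSubst-fresh z y θ z∉dom y∉dom z∉rng y∉rng)
       (trans (swap-openK z y 0 z K) (cong₂ (openK 0) (swapName-left z y) (swapK-fresh K z∉K y∉K)))
       (sym (open-closeK 0 z y K' lK' y∉K'))
       (swap-SubKᶜ z y d)

mutual
  SubCᶜ⇒SubC : ∀ {θ M N} → SubCᶜ θ M N → SubC θ M N
  SubCᶜ⇒SubC (sc-atm d) = c-atm (SubRᶜ⇒SubR d)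
  SubCᶜ⇒SubC (sc-can d) = c-can (SubRCᶜ⇒SubRC d)
  SubCᶜ⇒SubC {θ} (sc-lam {M} {N} L f) =
    let avoid = L ++ dom θ ++ fvsRng θ ++ fvsC M ++ fvsC N
        z = fresh avoid
        z∉L , z∉₁ = ∉-++⁻ L (fresh∉ avoid)
        z∉dom , z∉₂ = ∉-++⁻ (dom θ) z∉₁
        z∉rng , z∉₃ = ∉-++⁻ (fvsRng θ) z∉₂
        z∉M , z∉N = ∉-++⁻ (fvsC M) z∉₃
    in subst (λ t → SubC θ (lam M) (lam t)) (close-openC 0 z N z∉N)
         (c-lam z z∉dom (∉-fvsRng⇒FreshRng θ z∉rng) z∉M (SubCᶜ⇒SubC (f z z∉L)))

  SubRCᶜ⇒SubRC : ∀ {θ R M α} → SubRCᶜ θ R M α → SubRC θ R M α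
  SubRCᶜ⇒SubRC (src-var p) = rc-var p
  SubRCᶜ⇒SubRC (src-app {M₁ = M₁} h d L f) =
    let x = fresh (L ++ fvsC M₁)
        x∉L , x∉M₁ = ∉-++⁻ L (fresh∉ (L ++ fvsC M₁))
    in rc-app (SubRCᶜ⇒SubRC h) (SubCᶜ⇒SubC d) x x∉M₁ (SubCᶜ⇒SubC (f x x∉L))

  SubRᶜ⇒SubR : ∀ {θ R R'} → SubRᶜ θ R R' → SubR θ R R'
  SubRᶜ⇒SubR sr-con = r-con
  SubRᶜ⇒SubR (sr-var x∉) = r-var x∉
  SubRᶜ⇒SubR (sr-app d e) = r-app (SubRᶜ⇒SubR d) (SubCᶜ⇒SubC e)

SubPᶜ⇒SubP : ∀ {θ P P'} → SubPᶜ θ P P' → SubP θ P P'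
SubPᶜ⇒SubP sp-con = p-con
SubPᶜ⇒SubP (sp-app d e) = p-app (SubPᶜ⇒SubP d) (SubCᶜ⇒SubC e)

SubTᶜ⇒SubT : ∀ {θ A A'} → SubTᶜ θ A A' → SubT θ A A'
SubTᶜ⇒SubT (st-atm d) = t-atm (SubPᶜ⇒SubP d)
SubTᶜ⇒SubT {θ} (st-pi {A₁} {A₁'} {A₂} {A₂'} d L f) =
  let avoid = L ++ dom θ ++ fvsRng θ ++ fvsT A₂ ++ fvsT A₂'
      z = fresh avoid
      z∉L , z∉₁ = ∉-++⁻ L (fresh∉ avoid)
      z∉dom , z∉₂ = ∉-++⁻ (dom θ) z∉₁
      z∉rng , z∉₃ = ∉-++⁻ (fvsRng θ) z∉₂
      z∉A₂ , z∉A₂' = ∉-++⁻ (fvsT A₂) z∉₃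
  in subst (λ t → SubT θ (pi A₁ A₂) (pi A₁' t)) (close-openT 0 z A₂' z∉A₂')
       (t-pi z z∉dom (∉-fvsRng⇒FreshRng θ z∉rng) z∉A₂ (SubTᶜ⇒SubT d) (SubTᶜ⇒SubT (f z z∉L)))

SubKᶜ⇒SubK : ∀ {θ K K'} → SubKᶜ θ K K' → SubK θ K K'
SubKᶜ⇒SubK sk-type = k-type
SubKᶜ⇒SubK {θ} (sk-pi {A} {A'} {K} {K'} d L f) =
  let avoid = L ++ dom θ ++ fvsRng θ ++ fvsK K ++ fvsK K'
      z = fresh avoid
      z∉L , z∉₁ = ∉-++⁻ L (fresh∉ avoid)
      z∉dom , z∉₂ = ∉-++⁻ (dom θ) z∉₁
      z∉rng , z∉₃ = ∉-++⁻ (fvsRng θ) z∉₂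
      z∉K , z∉K' = ∉-++⁻ (fvsK K) z∉₃
  in subst (λ t → SubK θ (piK A K) (piK A' t)) (close-openK 0 z K' z∉K')
       (k-pi z z∉dom (∉-fvsRng⇒FreshRng θ z∉rng) z∉K (SubTᶜ⇒SubT d) (SubKᶜ⇒SubK (f z z∉L)))

LcRng : Subst → Set
LcRng θ = ∀ {x M α} → (x , M , α) ∈ θ → lcC 0 M

mutual
  SubC⇒SubCᶜ : ∀ {θ M N} → LcRng θ → lcC 0 M → SubC θ M N → SubCᶜ θ M N × lcC 0 N
  SubC⇒SubCᶜ lθ lM (c-atm d) = Product.map₁ sc-atm (SubR⇒SubRᶜ lθ lM d)
  SubC⇒SubCᶜ lθ lM (c-can d) = Product.map₁ sc-can (SubRC⇒SubRCᶜ lθ lM d)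
  SubC⇒SubCᶜ {θ} lθ lM (c-lam {M} {N} x x∉dom fr x∉M d) with SubC⇒SubCᶜ lθ (lc-openC 0 x M lM) d
  ... | d' , lN = sc-lam _ (SubCᶜ-reopen d' x∉dom (FreshRng⇒∉-fvsRng θ fr) x∉M lN) , lc-closeC 0 x N lN

  SubRC⇒SubRCᶜ : ∀ {θ R M α} → LcRng θ → lcA 0 R → SubRC θ R M α → SubRCᶜ θ R M α × lcC 0 M
  SubRC⇒SubRCᶜ lθ _ (rc-var p) = src-var p , lθ p
  SubRC⇒SubRCᶜ lθ (lR , lM) (rc-app {M₁ = M₁} h d x x∉ e)
    with SubRC⇒SubRCᶜ lθ lR h | SubC⇒SubCᶜ lθ lM d
  ... | h' , lλ | d' , lM'' with SubC⇒SubCᶜ (λ { (here refl) → lM'' }) (lc-openC 0 x M₁ lλ) e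
  ...   | e' , lM''' = src-app h' d' (x ∷ fvsC M₁) (SubCᶜ-single-rename e' x∉) , lM'''

  SubR⇒SubRᶜ : ∀ {θ R R'} → LcRng θ → lcA 0 R → SubR θ R R' → SubRᶜ θ R R' × lcA 0 R'
  SubR⇒SubRᶜ lθ _ r-con = sr-con , tt
  SubR⇒SubRᶜ lθ _ (r-var x∉) = sr-var x∉ , tt
  SubR⇒SubRᶜ lθ (lR , lM) (r-app d e) with SubR⇒SubRᶜ lθ lR d | SubC⇒SubCᶜ lθ lM e
  ... | d' , lR' | e' , lM' = sr-app d' e' , (lR' , lM')

SubP⇒SubPᶜ : ∀ {θ P P'} → LcRng θ → lcP 0 P → SubP θ P P' → SubPᶜ θ P P' × lcP 0 P'
SubP⇒SubPᶜ lθ _ p-con = sp-con , tt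
SubP⇒SubPᶜ lθ (lP , lM) (p-app d e) with SubP⇒SubPᶜ lθ lP d | SubC⇒SubCᶜ lθ lM e
... | d' , lP' | e' , lM' = sp-app d' e' , (lP' , lM')

SubT⇒SubTᶜ : ∀ {θ A A'} → LcRng θ → lcT 0 A → SubT θ A A' → SubTᶜ θ A A' × lcT 0 A'
SubT⇒SubTᶜ lθ lP (t-atm d) = Product.map₁ st-atm (SubP⇒SubPᶜ lθ lP d)
SubT⇒SubTᶜ {θ} lθ (lA₁ , lA₂) (t-pi {A₂ = A₂} {A₂' = A₂'} x x∉dom fr x∉A₂ d e)
  with SubT⇒SubTᶜ lθ lA₁ d | SubT⇒SubTᶜ lθ (lc-openT 0 x A₂ lA₂) e
... | d' , lA₁' | e' , lA₂' =
  st-pi d' _ (SubTᶜ-reopen e' x∉dom (FreshRng⇒∉-fvsRng θ fr) x∉A₂ lA₂') , (lA₁' , lc-closeT 0 x A₂' lA₂')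

SubK⇒SubKᶜ : ∀ {θ K K'} → LcRng θ → lcK 0 K → SubK θ K K' → SubKᶜ θ K K' × lcK 0 K'
SubK⇒SubKᶜ lθ _ k-type = sk-type , tt
SubK⇒SubKᶜ {θ} lθ (lA , lK) (k-pi {K = K} {K' = K'} x x∉dom fr x∉K d e)
  with SubT⇒SubTᶜ lθ lA d | SubK⇒SubKᶜ lθ (lc-openK 0 x K lK) e
... | d' , lA' | e' , lK' =
  sk-pi d' _ (SubKᶜ-reopen e' x∉dom (FreshRng⇒∉-fvsRng θ fr) x∉K lK') , (lA' , lc-closeK 0 x K' lK')

-- An arity context read as a predicate: extending it by a binder is then a plain
-- case split instead of ⊕ on lists, and λ is typed cofinitely.
PCtx : Set₁
PCtx = Sym → Arity → Set

ext : Name → Arity → PCtx → PCtx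
ext x β Γ s α = (s ≡ var x × α ≡ β) ⊎ (s ≢ var x × Γ s α)

⟦_⟧ : ArCtx → PCtx
⟦ Θ ⟧ s α = (s , α) ∈ Θ

mutual
  data Syn (Γ : PCtx) : Atm → Arity → Set where
    syn-con : ∀ {c α} → Γ (cst c) α → Syn Γ (con c) α
    syn-var : ∀ {x α} → Γ (var x) α → Syn Γ (fv x) α
    syn-app : ∀ {R M α α'} → Syn Γ R (α' ⟶ α) → Chk Γ M α' → Syn Γ (app R M) α

  data Chk (Γ : PCtx) : Can → Arity → Set where
    chk-lam : ∀ {M α₁ α₂} (L : List Name) → (∀ x → x ∉ L → Chk (ext x α₁ Γ) (openC 0 x M) α₂) →
              Chk Γ (lam M) (α₁ ⟶ α₂)
    chk-atm : ∀ {R} → Syn Γ R o → Chk Γ (atm R) o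

data RespPᶜ (Γ : PCtx) : ATy → Set where
  rpᶜ-con : ∀ {a} → RespPᶜ Γ (tcon a)
  rpᶜ-app : ∀ {P M α} → RespPᶜ Γ P → Chk Γ M α → RespPᶜ Γ (tapp P M)

data RespTᶜ (Γ : PCtx) : Ty → Set where
  rtᶜ-atm : ∀ {P} → RespPᶜ Γ P → RespTᶜ Γ (atyp P)
  rtᶜ-pi  : ∀ {A₁ A₂} → RespTᶜ Γ A₁ → (L : List Name) →
            (∀ z → z ∉ L → RespTᶜ (ext z (erase A₁) Γ) (openT 0 z A₂)) → RespTᶜ Γ (pi A₁ A₂)

data RespKᶜ (Γ : PCtx) : Kind → Set where
  rkᶜ-type : RespKᶜ Γ type
  rkᶜ-pi   : ∀ {A K} → RespTᶜ Γ A → (L : List Name) →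
             (∀ z → z ∉ L → RespKᶜ (ext z (erase A) Γ) (openK 0 z K)) → RespKᶜ Γ (piK A K)

var-injective : ∀ {y x} → var y ≡ var x → y ≡ x
var-injective refl = refl

cst≢var : ∀ {c x} → cst c ≢ var x
cst≢var ()

record Agree (Γ Γ' : PCtx) (xs : List Name) : Set where
  constructor _,ₛ_
  field
    agree-cst : ∀ {c β} → Γ (cst c) β → Γ' (cst c) β
    agree-var : ∀ {y β} → y ∈ xs → Γ (var y) β → Γ' (var y) β

Agree-refl : ∀ {Γ} xs → Agree Γ Γ xs
Agree-refl xs = (λ g → g) ,ₛ λ _ g → g

Agree-++ˡ : ∀ {Γ Γ' xs} ys → Agree Γ Γ' (xs ++ ys) → Agree Γ Γ' xs
Agree-++ˡ ys (c ,ₛ v) = c ,ₛ λ p → v (∈-++⁺ˡ p)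

Agree-++ʳ : ∀ {Γ Γ' ys} xs → Agree Γ Γ' (xs ++ ys) → Agree Γ Γ' ys
Agree-++ʳ xs (c ,ₛ v) = c ,ₛ λ p → v (∈-++⁺ʳ xs p)

Agree-ext : ∀ {Γ Γ' x β} xs ys → (∀ {y} → y ∈ ys → y ≢ x → y ∈ xs) →
            Agree Γ Γ' xs → Agree (ext x β Γ) (ext x β Γ') ys
Agree-ext xs ys ys⊆xs (c ,ₛ v) =
  (λ { (inj₁ (e , _)) → ⊥-elim (cst≢var e) ; (inj₂ (_ , g)) → inj₂ (cst≢var , c g) }) ,ₛ
  (λ { p (inj₁ e) → inj₁ e ; p (inj₂ (y≢x , g)) → inj₂ (y≢x , v (ys⊆xs p (λ e → y≢x (cong var e))) g) })

fvs-openC-≢ : ∀ k x M {y} → y ∈ fvsC (openC k x M) → y ≢ x → y ∈ fvsC M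
fvs-openC-≢ k x M p y≢x = Sum.[ (λ e → ⊥-elim (y≢x e)) , (λ q → q) ] (fvs-openC k x M p)

fvs-openT-≢ : ∀ k x A {y} → y ∈ fvsT (openT k x A) → y ≢ x → y ∈ fvsT A
fvs-openT-≢ k x A p y≢x = Sum.[ (λ e → ⊥-elim (y≢x e)) , (λ q → q) ] (fvs-openT k x A p)

fvs-openK-≢ : ∀ k x K {y} → y ∈ fvsK (openK k x K) → y ≢ x → y ∈ fvsK K
fvs-openK-≢ k x K p y≢x = Sum.[ (λ e → ⊥-elim (y≢x e)) , (λ q → q) ] (fvs-openK k x K p)

mutual
  weaken-Chk : ∀ {Γ Γ' M α} → Chk Γ M α → Agree Γ Γ' (fvsC M) → Chk Γ' M α
  weaken-Chk {M = lam M} (chk-lam L f) s =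
    chk-lam L λ x x∉ → weaken-Chk (f x x∉) (Agree-ext (fvsC M) _ (fvs-openC-≢ 0 x M) s)
  weaken-Chk (chk-atm d) s = chk-atm (weaken-Syn d s)

  weaken-Syn : ∀ {Γ Γ' R α} → Syn Γ R α → Agree Γ Γ' (fvsA R) → Syn Γ' R α
  weaken-Syn (syn-con g) (c ,ₛ v) = syn-con (c g)
  weaken-Syn (syn-var g) (c ,ₛ v) = syn-var (v (here refl) g)
  weaken-Syn {R = app R M} (syn-app d e) s =
    syn-app (weaken-Syn d (Agree-++ˡ (fvsC M) s)) (weaken-Chk e (Agree-++ʳ (fvsA R) s))

weaken-RespPᶜ : ∀ {Γ Γ' P} → RespPᶜ Γ P → Agree Γ Γ' (fvsP P) → RespPᶜ Γ' P
weaken-RespPᶜ rpᶜ-con s = rpᶜ-con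
weaken-RespPᶜ {P = tapp P M} (rpᶜ-app d e) s =
  rpᶜ-app (weaken-RespPᶜ d (Agree-++ˡ (fvsC M) s)) (weaken-Chk e (Agree-++ʳ (fvsP P) s))

weaken-RespTᶜ : ∀ {Γ Γ' A} → RespTᶜ Γ A → Agree Γ Γ' (fvsT A) → RespTᶜ Γ' A
weaken-RespTᶜ (rtᶜ-atm d) s = rtᶜ-atm (weaken-RespPᶜ d s)
weaken-RespTᶜ {A = pi A₁ A₂} (rtᶜ-pi d L f) s =
  rtᶜ-pi (weaken-RespTᶜ d (Agree-++ˡ (fvsT A₂) s)) L λ z z∉ →
    weaken-RespTᶜ (f z z∉) (Agree-ext (fvsT A₂) _ (fvs-openT-≢ 0 z A₂) (Agree-++ʳ (fvsT A₁) s))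

weaken-RespKᶜ : ∀ {Γ Γ' K} → RespKᶜ Γ K → Agree Γ Γ' (fvsK K) → RespKᶜ Γ' K
weaken-RespKᶜ rkᶜ-type s = rkᶜ-type
weaken-RespKᶜ {K = piK A K} (rkᶜ-pi d L f) s =
  rkᶜ-pi (weaken-RespTᶜ d (Agree-++ˡ (fvsK K) s)) L λ z z∉ →
    weaken-RespKᶜ (f z z∉) (Agree-ext (fvsK K) _ (fvs-openK-≢ 0 z K) (Agree-++ʳ (fvsT A) s))

swapSym : Name → Name → Sym → Sym
swapSym a b (var x) = var (swapName a b x)
swapSym a b (cst c) = cst c

swapPCtx : Name → Name → PCtx → PCtx
swapPCtx a b Γ s α = Γ (swapSym a b s) α

Agree-swapPCtx-ext : ∀ a b z β Γ xs →
                     Agree (swapPCtx a b (ext (swapName a b z) β Γ)) (ext z β (swapPCtx a b Γ)) xs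
Agree-swapPCtx-ext a b z β Γ xs = agree-cst ,ₛ λ _ → agree-var
  where
    agree-cst : ∀ {c α} → swapPCtx a b (ext (swapName a b z) β Γ) (cst c) α → ext z β (swapPCtx a b Γ) (cst c) α
    agree-cst (inj₁ (e , _)) = ⊥-elim (cst≢var e)
    agree-cst (inj₂ (_ , g)) = inj₂ (cst≢var , g)
    agree-var : ∀ {y α} → swapPCtx a b (ext (swapName a b z) β Γ) (var y) α → ext z β (swapPCtx a b Γ) (var y) α
    agree-var (inj₁ (e , r)) = inj₁ (cong var (swapName-injective a b (var-injective e)) , r)
    agree-var (inj₂ (y≢z , g)) = inj₂ ((λ e → y≢z (cong var (cong (swapName a b) (var-injective e)))) , g)

mutual
  swap-Chk : ∀ a b {Γ M α} → Chk Γ M α → Chk (swapPCtx a b Γ) (swapC a b M) α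
  swap-Chk a b {Γ} (chk-lam {M} {α₁} L f) = chk-lam (map (swapName a b) L) λ z z∉ →
    weaken-Chk (subst (λ t → Chk _ t _) (swap-openC-swapped a b z M)
                      (swap-Chk a b (f (swapName a b z) (∉-map-swapName a b L z∉))))
               (Agree-swapPCtx-ext a b z α₁ Γ _)
  swap-Chk a b (chk-atm d) = chk-atm (swap-Syn a b d)

  swap-Syn : ∀ a b {Γ R α} → Syn Γ R α → Syn (swapPCtx a b Γ) (swapA a b R) α
  swap-Syn a b (syn-con g) = syn-con g
  swap-Syn a b {Γ} (syn-var {x} {α} g) = syn-var (subst (λ y → Γ (var y) α) (sym (swapName-involutive a b x)) g)
  swap-Syn a b (syn-app d e) = syn-app (swap-Syn a b d) (swap-Chk a b e)

swap-RespPᶜ : ∀ a b {Γ P} → RespPᶜ Γ P → RespPᶜ (swapPCtx a b Γ) (swapP a b P)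
swap-RespPᶜ a b rpᶜ-con = rpᶜ-con
swap-RespPᶜ a b (rpᶜ-app d e) = rpᶜ-app (swap-RespPᶜ a b d) (swap-Chk a b e)

erase-swapT : ∀ a b A → erase (swapT a b A) ≡ erase A
erase-swapT a b (atyp P) = refl
erase-swapT a b (pi A B) = cong₂ _⟶_ (erase-swapT a b A) (erase-swapT a b B)

Agree-swapPCtx-ext-erase : ∀ a b z A Γ xs →
  Agree (swapPCtx a b (ext (swapName a b z) (erase A) Γ)) (ext z (erase (swapT a b A)) (swapPCtx a b Γ)) xs
Agree-swapPCtx-ext-erase a b z A Γ xs =
  subst (λ β → Agree (swapPCtx a b (ext (swapName a b z) (erase A) Γ)) (ext z β (swapPCtx a b Γ)) xs)
        (sym (erase-swapT a b A)) (Agree-swapPCtx-ext a b z (erase A) Γ xs)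

swap-RespTᶜ : ∀ a b {Γ A} → RespTᶜ Γ A → RespTᶜ (swapPCtx a b Γ) (swapT a b A)
swap-RespTᶜ a b (rtᶜ-atm d) = rtᶜ-atm (swap-RespPᶜ a b d)
swap-RespTᶜ a b {Γ} (rtᶜ-pi {A₁} {A₂} d L f) = rtᶜ-pi (swap-RespTᶜ a b d) (map (swapName a b) L) λ z z∉ →
  weaken-RespTᶜ (subst (RespTᶜ _) (swap-openT-swapped a b z A₂)
                       (swap-RespTᶜ a b (f (swapName a b z) (∉-map-swapName a b L z∉))))
                (Agree-swapPCtx-ext-erase a b z A₁ Γ _)

swap-RespKᶜ : ∀ a b {Γ K} → RespKᶜ Γ K → RespKᶜ (swapPCtx a b Γ) (swapK a b K)
swap-RespKᶜ a b rkᶜ-type = rkᶜ-type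
swap-RespKᶜ a b {Γ} (rkᶜ-pi {A} {K} d L f) = rkᶜ-pi (swap-RespTᶜ a b d) (map (swapName a b) L) λ z z∉ →
  weaken-RespKᶜ (subst (RespKᶜ _) (swap-openK-swapped a b z K)
                       (swap-RespKᶜ a b (f (swapName a b z) (∉-map-swapName a b L z∉))))
                (Agree-swapPCtx-ext-erase a b z A Γ _)

≡ˢ-refl : ∀ s → (s ≡ˢ s) ≡ true
≡ˢ-refl (var x) = ≡ᵇ-refl x
≡ˢ-refl (cst c) = ≡ᵇ-refl c

≡ˢ-true⇒≡ : ∀ t s → (t ≡ˢ s) ≡ true → t ≡ s
≡ˢ-true⇒≡ (var x) (var y) e = cong var (≡ᵇ-true⇒≡ x y e)
≡ˢ-true⇒≡ (cst c) (cst d) e = cong cst (≡ᵇ-true⇒≡ c d e)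

∈⇒assigned : ∀ {s β} Θ → (s , β) ∈ Θ → assigned s Θ ≡ true
∈⇒assigned {s} ((t , _) ∷ Θ) (here refl) rewrite ≡ˢ-refl s = refl
∈⇒assigned ((t , _) ∷ Θ) (there p) rewrite ∈⇒assigned Θ p = ∨-zeroʳ _

assigned⇒∈ : ∀ s Θ → assigned s Θ ≡ true → Σ Arity λ β → (s , β) ∈ Θ
assigned⇒∈ s ((t , β) ∷ Θ) e with t ≡ˢ s in t≡s
... | true = β , here (cong (_, β) (sym (≡ˢ-true⇒≡ t s t≡s)))
... | false = Product.map₂ there (assigned⇒∈ s Θ e)

¬assigned⇒∉ : ∀ {s β} Θ → assigned s Θ ≡ false → (s , β) ∉ Θ
¬assigned⇒∉ Θ e p with () ← trans (sym (∈⇒assigned Θ p)) e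

∈-unassignedIn⁻ : ∀ {s β} Θ₁ Θ₂ → (s , β) ∈ unassignedIn Θ₁ Θ₂ → (s , β) ∈ Θ₂ × assigned s Θ₁ ≡ false
∈-unassignedIn⁻ Θ₁ ((t , γ) ∷ Θ₂) p with assigned t Θ₁ in e
∈-unassignedIn⁻ Θ₁ ((t , γ) ∷ Θ₂) p         | true  = Product.map₁ there (∈-unassignedIn⁻ Θ₁ Θ₂ p)
∈-unassignedIn⁻ Θ₁ ((t , γ) ∷ Θ₂) (here refl) | false = here refl , e
∈-unassignedIn⁻ Θ₁ ((t , γ) ∷ Θ₂) (there p)   | false = Product.map₁ there (∈-unassignedIn⁻ Θ₁ Θ₂ p)

∈-unassignedIn⁺ : ∀ {s β} Θ₁ Θ₂ → (s , β) ∈ Θ₂ → assigned s Θ₁ ≡ false → (s , β) ∈ unassignedIn Θ₁ Θ₂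
∈-unassignedIn⁺ Θ₁ ((t , γ) ∷ Θ₂) (here refl) e rewrite e = here refl
∈-unassignedIn⁺ Θ₁ ((t , γ) ∷ Θ₂) (there p) e with assigned t Θ₁
... | true = ∈-unassignedIn⁺ Θ₁ Θ₂ p e
... | false = there (∈-unassignedIn⁺ Θ₁ Θ₂ p e)

∈-⊕⁻ : ∀ {s β} Θ₁ Θ₂ → (s , β) ∈ Θ₁ ⊕ Θ₂ → (s , β) ∈ Θ₁ ⊎ ((s , β) ∈ Θ₂ × assigned s Θ₁ ≡ false)
∈-⊕⁻ Θ₁ Θ₂ p = Sum.map₂ (∈-unassignedIn⁻ Θ₁ Θ₂) (∈-++⁻ Θ₁ p)

∈-⊕⁺ʳ : ∀ {s β} Θ₁ Θ₂ → (s , β) ∈ Θ₂ → assigned s Θ₁ ≡ false → (s , β) ∈ Θ₁ ⊕ Θ₂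
∈-⊕⁺ʳ Θ₁ Θ₂ p e = ∈-++⁺ʳ Θ₁ (∈-unassignedIn⁺ Θ₁ Θ₂ p e)

∈-singleton-⊕⁻ : ∀ {s β x α} Θ → (s , β) ∈ ((var x , α) ∷ []) ⊕ Θ → ext x α ⟦ Θ ⟧ s β
∈-singleton-⊕⁻ Θ (here refl) = inj₁ (refl , refl)
∈-singleton-⊕⁻ {x = x} {α} Θ (there p) with ∈-unassignedIn⁻ ((var x , α) ∷ []) Θ p
... | q , unassigned = inj₂ ((λ { refl → ¬assigned⇒∉ ((var x , α) ∷ []) unassigned (here refl) }) , q)

Agree-⊆ˡ : ∀ {Γ₀ Γ Γ' xs} → (∀ {s β} → Γ₀ s β → Γ s β) → Agree Γ Γ' xs → Agree Γ₀ Γ' xs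
Agree-⊆ˡ Γ₀⊆Γ (c ,ₛ v) = (λ g → c (Γ₀⊆Γ g)) ,ₛ λ p g → v p (Γ₀⊆Γ g)

Agree-singleton-⊕ : ∀ {Γ x α Θ} xs ys → (∀ {y} → y ∈ ys → y ≢ x → y ∈ xs) → Agree ⟦ Θ ⟧ Γ xs →
                    Agree ⟦ ((var x , α) ∷ []) ⊕ Θ ⟧ (ext x α Γ) ys
Agree-singleton-⊕ {Θ = Θ} xs ys ys⊆xs s = Agree-⊆ˡ (∈-singleton-⊕⁻ Θ) (Agree-ext xs ys ys⊆xs s)

Agree-swap-binder : ∀ x z β Γ xs → (∀ {y} → y ∈ xs → y ≡ z ⊎ (y ≢ x × y ≢ z)) →
                    Agree (swapPCtx x z (ext x β Γ)) (ext z β Γ) xs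
Agree-swap-binder x z β Γ xs xs-fresh = agree-cst ,ₛ agree-var
  where
    agree-cst : ∀ {c γ} → ext x β Γ (cst c) γ → ext z β Γ (cst c) γ
    agree-cst (inj₁ (e , _)) = ⊥-elim (cst≢var e)
    agree-cst (inj₂ (_ , g)) = inj₂ (cst≢var , g)
    agree-var : ∀ {y γ} → y ∈ xs → ext x β Γ (var (swapName x z y)) γ → ext z β Γ (var y) γ
    agree-var p g with xs-fresh p
    agree-var p (inj₁ (_ , r))     | inj₁ refl = inj₁ (refl , r)
    agree-var p (inj₂ (≢x , _))    | inj₁ refl = ⊥-elim (≢x (cong var (swapName-right x z)))
    agree-var p g                  | inj₂ (y≢x , y≢z) rewrite swapName-other y≢x y≢z with g
    ... | inj₁ (e , _) = ⊥-elim (y≢x (var-injective e))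
    ... | inj₂ (_ , g') = inj₂ ((λ e → y≢z (var-injective e)) , g')

fvs-open-cases : ∀ {y x z} {xs : List Name} → y ≡ z ⊎ y ∈ xs → x ∉ xs → z ∉ xs → y ≡ z ⊎ (y ≢ x × y ≢ z)
fvs-open-cases (inj₁ e) _ _ = inj₁ e
fvs-open-cases (inj₂ p) x∉ z∉ = inj₂ ((λ { refl → x∉ p }) , (λ { refl → z∉ p }))

rename-binder-Chk : ∀ {Γ x α₁ M α₂} → Chk (ext x α₁ Γ) (openC 0 x M) α₂ → x ∉ fvsC M →
                    ∀ z → z ∉ fvsC M → Chk (ext z α₁ Γ) (openC 0 z M) α₂
rename-binder-Chk {Γ} {x} {α₁} {M} d x∉ z z∉ =
  weaken-Chk (subst (λ t → Chk _ t _)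
                    (trans (swap-openC x z 0 x M) (cong₂ (openC 0) (swapName-left x z) (swapC-fresh M x∉ z∉)))
                    (swap-Chk x z d))
             (Agree-swap-binder x z α₁ Γ _ λ p → fvs-open-cases (fvs-openC 0 z M p) x∉ z∉)

rename-binder-RespTᶜ : ∀ {Γ x α A} → RespTᶜ (ext x α Γ) (openT 0 x A) → x ∉ fvsT A →
                       ∀ z → z ∉ fvsT A → RespTᶜ (ext z α Γ) (openT 0 z A)
rename-binder-RespTᶜ {Γ} {x} {α} {A} d x∉ z z∉ =
  weaken-RespTᶜ (subst (RespTᶜ _)
                       (trans (swap-openT x z 0 x A) (cong₂ (openT 0) (swapName-left x z) (swapT-fresh A x∉ z∉)))
                       (swap-RespTᶜ x z d))
                (Agree-swap-binder x z α Γ _ λ p → fvs-open-cases (fvs-openT 0 z A p) x∉ z∉)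

rename-binder-RespKᶜ : ∀ {Γ x α K} → RespKᶜ (ext x α Γ) (openK 0 x K) → x ∉ fvsK K →
                       ∀ z → z ∉ fvsK K → RespKᶜ (ext z α Γ) (openK 0 z K)
rename-binder-RespKᶜ {Γ} {x} {α} {K} d x∉ z z∉ =
  weaken-RespKᶜ (subst (RespKᶜ _)
                       (trans (swap-openK x z 0 x K) (cong₂ (openK 0) (swapName-left x z) (swapK-fresh K x∉ z∉)))
                       (swap-RespKᶜ x z d))
                (Agree-swap-binder x z α Γ _ λ p → fvs-open-cases (fvs-openK 0 z K p) x∉ z∉)

mutual
  ⊢⇐⇒Chk : ∀ {Θ Γ M α} → Θ ⊢ M ⇐ α → Agree ⟦ Θ ⟧ Γ (fvsC M) → Chk Γ M α
  ⊢⇐⇒Chk {M = lam M} (⇐lam x x∉ d) s =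
    chk-lam (fvsC M) λ z z∉ →
      rename-binder-Chk (⊢⇐⇒Chk d (Agree-singleton-⊕ (fvsC M) _ (fvs-openC-≢ 0 x M) s)) x∉ z z∉
  ⊢⇐⇒Chk (⇐atm d) s = chk-atm (⊢⇒⇒Syn d s)

  ⊢⇒⇒Syn : ∀ {Θ Γ R α} → Θ ⊢ R ⇒ α → Agree ⟦ Θ ⟧ Γ (fvsA R) → Syn Γ R α
  ⊢⇒⇒Syn (⇒con p) (c ,ₛ v) = syn-con (c p)
  ⊢⇒⇒Syn (⇒var p) (c ,ₛ v) = syn-var (v (here refl) p)
  ⊢⇒⇒Syn {R = app R M} (⇒app d e) s =
    syn-app (⊢⇒⇒Syn d (Agree-++ˡ (fvsC M) s)) (⊢⇐⇒Chk e (Agree-++ʳ (fvsA R) s))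

RespP⇒RespPᶜ : ∀ {Θ Γ P} → RespP Θ P → Agree ⟦ Θ ⟧ Γ (fvsP P) → RespPᶜ Γ P
RespP⇒RespPᶜ rp-con s = rpᶜ-con
RespP⇒RespPᶜ {P = tapp P M} (rp-app d e) s =
  rpᶜ-app (RespP⇒RespPᶜ d (Agree-++ˡ (fvsC M) s)) (⊢⇐⇒Chk e (Agree-++ʳ (fvsP P) s))

RespT⇒RespTᶜ : ∀ {Θ Γ A} → RespT Θ A → Agree ⟦ Θ ⟧ Γ (fvsT A) → RespTᶜ Γ A
RespT⇒RespTᶜ (rt-atm d) s = rtᶜ-atm (RespP⇒RespPᶜ d s)
RespT⇒RespTᶜ {A = pi A₁ A₂} (rt-pi d x x∉ e) s =
  rtᶜ-pi (RespT⇒RespTᶜ d (Agree-++ˡ (fvsT A₂) s)) (fvsT A₂) λ z z∉ →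
    rename-binder-RespTᶜ
      (RespT⇒RespTᶜ e (Agree-singleton-⊕ (fvsT A₂) _ (fvs-openT-≢ 0 x A₂) (Agree-++ʳ (fvsT A₁) s))) x∉ z z∉

RespK⇒RespKᶜ : ∀ {Θ Γ K} → RespK Θ K → Agree ⟦ Θ ⟧ Γ (fvsK K) → RespKᶜ Γ K
RespK⇒RespKᶜ rk-type s = rkᶜ-type
RespK⇒RespKᶜ {K = piK A K} (rk-pi d x x∉ e) s =
  rkᶜ-pi (RespT⇒RespTᶜ d (Agree-++ˡ (fvsK K) s)) (fvsK K) λ z z∉ →
    rename-binder-RespKᶜ
      (RespK⇒RespKᶜ e (Agree-singleton-⊕ (fvsK K) _ (fvs-openK-≢ 0 x K) (Agree-++ʳ (fvsT A) s))) x∉ z z∉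

mutual
  Chk-lc : ∀ {Γ M α} → Chk Γ M α → lcC 0 M
  Chk-lc {M = lam M} (chk-lam L f) = lc-openC⁻ 0 (fresh L) M (Chk-lc (f (fresh L) (fresh∉ L)))
  Chk-lc (chk-atm d) = Syn-lc d

  Syn-lc : ∀ {Γ R α} → Syn Γ R α → lcA 0 R
  Syn-lc (syn-con _) = tt
  Syn-lc (syn-var _) = tt
  Syn-lc (syn-app d e) = Syn-lc d , Chk-lc e

RespPᶜ-lc : ∀ {Γ P} → RespPᶜ Γ P → lcP 0 P
RespPᶜ-lc rpᶜ-con = tt
RespPᶜ-lc (rpᶜ-app d e) = RespPᶜ-lc d , Chk-lc e

RespTᶜ-lc : ∀ {Γ A} → RespTᶜ Γ A → lcT 0 A
RespTᶜ-lc (rtᶜ-atm d) = RespPᶜ-lc d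
RespTᶜ-lc {A = pi A₁ A₂} (rtᶜ-pi d L f) =
  RespTᶜ-lc d , lc-openT⁻ 0 (fresh L) A₂ (RespTᶜ-lc (f (fresh L) (fresh∉ L)))

RespKᶜ-lc : ∀ {Γ K} → RespKᶜ Γ K → lcK 0 K
RespKᶜ-lc rkᶜ-type = tt
RespKᶜ-lc {K = piK A K} (rkᶜ-pi d L f) =
  RespTᶜ-lc d , lc-openK⁻ 0 (fresh L) K (RespKᶜ-lc (f (fresh L) (fresh∉ L)))

NotDom : Sym → Subst → Set
NotDom (var x) θ = x ∉ dom θ
NotDom (cst c) θ = ⊤

-- The conditions under which θ carries arity typing in Γ to arity typing in Γ'.
record Sends (θ : Subst) (Γ Γ' : PCtx) : Set where
  field
    rng-Chk     : ∀ {x M α} → (x , M , α) ∈ θ → Chk Γ' M α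
    keep        : ∀ {s β} → Γ s β → NotDom s θ → Γ' s β
    arity-match : ∀ {x M α β} → (x , M , α) ∈ θ → Γ (var x) β → α ≡ β
open Sends

weaken-fresh-Chk : ∀ {Γ z β M α} → Chk Γ M α → z ∉ fvsC M → Chk (ext z β Γ) M α
weaken-fresh-Chk d z∉ =
  weaken-Chk d ((λ g → inj₂ (cst≢var , g)) ,ₛ λ p g → inj₂ ((λ { refl → z∉ p }) , g))

Sends-ext : ∀ {θ Γ Γ' z β} → Sends θ Γ Γ' → z ∉ dom θ → z ∉ fvsRng θ → Sends θ (ext z β Γ) (ext z β Γ')
Sends-ext {θ} σ z∉dom z∉rng = record
  { rng-Chk     = λ m → weaken-fresh-Chk (rng-Chk σ m) (λ p → z∉rng (∈-fvsRng θ m p))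
  ; keep        = λ { (inj₁ e) _ → inj₁ e ; (inj₂ (s≢z , g)) s∉ → inj₂ (s≢z , keep σ g s∉) }
  ; arity-match = λ { m (inj₁ (e , _)) → ⊥-elim (z∉dom (subst (_∈ dom θ) (var-injective e) (∈⇒∈-dom θ m)))
                    ; m (inj₂ (_ , g)) → arity-match σ m g } }

Sends-single : ∀ {Γ x N α} → Chk Γ N α → Sends (single x N α) (ext x α Γ) Γ
Sends-single t = record
  { rng-Chk     = λ { (here refl) → t }
  ; keep        = λ { {var y} (inj₁ (refl , _)) y∉ → ⊥-elim (y∉ (here refl))
                    ; {cst c} (inj₁ (() , _)) _
                    ; (inj₂ (_ , g)) _ → g }
  ; arity-match = λ { (here refl) (inj₁ (_ , r)) → sym r ; (here refl) (inj₂ (x≢x , _)) → ⊥-elim (x≢x refl) } }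

AritiesBelow-single : ∀ {n x N α} → aritySize α ≤ n → AritiesBelow n (single x N α)
AritiesBelow-single α≤n (here refl) = α≤n

AritiesBelow-mono : ∀ {m n θ} → m ≤ n → AritiesBelow m θ → AritiesBelow n θ
AritiesBelow-mono m≤n below p = ≤-trans (below p) m≤n

IsSubst-single : ∀ {x N α} → IsSubst (single x N α)
IsSubst-single = [] ∷ []

dom-below : ∀ {α β n} → aritySize (α ⟶ β) ≤ suc n → aritySize α ≤ n
dom-below {α} p = m+n≤o⇒m≤o (aritySize α) (s≤s⁻¹ p)

SubRCᶜ-arity-below : ∀ {n θ R M γ} → AritiesBelow n θ → SubRCᶜ θ R M γ → aritySize γ ≤ n
SubRCᶜ-arity-below below (src-var m) = below m
SubRCᶜ-arity-below below (src-app {α' = α'} {α'' = α''} h _ _ _) =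
  ≤-trans (m≤n⇒m≤1+n (m≤n+m (aritySize α'') (aritySize α'))) (SubRCᶜ-arity-below below h)

-- The recursion is on a bound n for the arities in θ: the β-reduction in an application
-- substitutes at the strictly smaller domain arity.
mutual
  preserveC : ∀ n {θ Γ Γ' M N α} → AritiesBelow n θ → Sends θ Γ Γ' → Chk Γ M α → SubCᶜ θ M N → Chk Γ' N α
  preserveC n below σ (chk-atm d) (sc-atm e) = chk-atm (preserveR n below σ d e)
  preserveC n below σ (chk-atm d) (sc-can e) with preserveRC n below σ d e
  ... | refl , t = t
  preserveC n {θ} below σ (chk-lam L f) (sc-lam L' g) = chk-lam (L ++ L' ++ dom θ ++ fvsRng θ) λ z z∉ →
    let z∉L , z∉₁ = ∉-++⁻ L z∉
        z∉L' , z∉₂ = ∉-++⁻ L' z∉₁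
        z∉dom , z∉rng = ∉-++⁻ (dom θ) z∉₂
    in preserveC n below (Sends-ext σ z∉dom z∉rng) (f z z∉L) (g z z∉L')

  preserveRC : ∀ n {θ Γ Γ' R M α δ} → AritiesBelow n θ → Sends θ Γ Γ' → Syn Γ R δ → SubRCᶜ θ R M α →
               α ≡ δ × Chk Γ' M α
  preserveRC n below σ (syn-var g) (src-var m) = arity-match σ m g , rng-Chk σ m
  preserveRC n below σ (syn-app d e) (src-app h a L f) with preserveRC n below σ d h
  ... | refl , tλ = refl , preserveRC-app n below h (preserveC n below σ e a) tλ L f

  preserveRC-app : ∀ n {θ Γ R M₁ M'' M''' α' α''} → AritiesBelow n θ →
                   SubRCᶜ θ R (lam M₁) (α' ⟶ α'') → Chk Γ M'' α' → Chk Γ (lam M₁) (α' ⟶ α'') →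
                   (L : List Name) → (∀ x → x ∉ L → SubCᶜ (single x M'' α') (openC 0 x M₁) M''') →
                   Chk Γ M''' α''
  preserveRC-app zero below h _ _ _ _ with () ← SubRCᶜ-arity-below below h
  preserveRC-app (suc n) below h tM'' (chk-lam Lt gl) L f =
    let x = fresh (L ++ Lt)
        x∉L , x∉Lt = ∉-++⁻ L (fresh∉ (L ++ Lt))
    in preserveC n (AritiesBelow-single (dom-below (SubRCᶜ-arity-below below h))) (Sends-single tM'')
                 (gl x x∉Lt) (f x x∉L)

  preserveR : ∀ n {θ Γ Γ' R R' δ} → AritiesBelow n θ → Sends θ Γ Γ' → Syn Γ R δ → SubRᶜ θ R R' → Syn Γ' R' δ
  preserveR n below σ (syn-con g) sr-con = syn-con (keep σ g tt)
  preserveR n below σ (syn-var g) (sr-var x∉) = syn-var (keep σ g x∉)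
  preserveR n below σ (syn-app d e) (sr-app a b) = syn-app (preserveR n below σ d a) (preserveC n below σ e b)

mutual
  existsC : ∀ n {θ Γ Γ' M α} → AritiesBelow n θ → Sends θ Γ Γ' → Chk Γ M α → Σ Can (SubCᶜ θ M)
  existsC n below σ (chk-atm d) with existsR n below σ d
  ... | inj₁ (R' , e) = atm R' , sc-atm e
  ... | inj₂ (N , e) = N , sc-can e
  existsC n {θ} below σ (chk-lam {M} L f) =
    let avoid = L ++ dom θ ++ fvsRng θ ++ fvsC M
        z = fresh avoid
        z∉L , z∉₁ = ∉-++⁻ L (fresh∉ avoid)
        z∉dom , z∉₂ = ∉-++⁻ (dom θ) z∉₁
        z∉rng , z∉M = ∉-++⁻ (fvsRng θ) z∉₂
        σ' = Sends-ext σ z∉dom z∉rng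
        N , d = existsC n below σ' (f z z∉L)
        lN = Chk-lc (preserveC n below σ' (f z z∉L) d)
    in lam (closeC 0 z N) , sc-lam _ (SubCᶜ-reopen d z∉dom z∉rng z∉M lN)

  existsR : ∀ n {θ Γ Γ' R δ} → AritiesBelow n θ → Sends θ Γ Γ' → Syn Γ R δ →
            Σ Atm (SubRᶜ θ R) ⊎ Σ Can (λ M → SubRCᶜ θ R M δ)
  existsR n below σ (syn-con g) = inj₁ (_ , sr-con)
  existsR n {θ} below σ (syn-var {x} g) with x ∈? dom θ
  ... | no x∉ = inj₁ (_ , sr-var x∉)
  ... | yes x∈ with ∈-dom⇒∈ θ x∈
  ...   | M , α , m = inj₂ (M , subst (SubRCᶜ θ (fv x) M) (arity-match σ m g) (src-var m))
  existsR n below σ (syn-app d e) with existsR n below σ d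
  ... | inj₁ (R' , h) = inj₁ (_ , sr-app h (proj₂ (existsC n below σ e)))
  ... | inj₂ (_ , h) = inj₂ (existsRC-app n below σ h e (proj₂ (preserveRC n below σ d h)))

  existsRC-app : ∀ n {θ Γ Γ' R Λ N α' α} → AritiesBelow n θ → Sends θ Γ Γ' → SubRCᶜ θ R Λ (α' ⟶ α) →
                 Chk Γ N α' → Chk Γ' Λ (α' ⟶ α) → Σ Can (λ M → SubRCᶜ θ (app R N) M α)
  existsRC-app zero below σ h _ _ with () ← SubRCᶜ-arity-below below h
  existsRC-app (suc n) below σ h e (chk-lam {M₁} Lt gl) =
    let N' , dN = existsC (suc n) below σ e
        x = fresh (Lt ++ fvsC M₁)
        x∉Lt , x∉M₁ = ∉-++⁻ Lt (fresh∉ (Lt ++ fvsC M₁))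
        M , dM = existsC n (AritiesBelow-single (dom-below (SubRCᶜ-arity-below below h)))
                         (Sends-single (preserveC (suc n) below σ e dN)) (gl x x∉Lt)
    in M , src-app h dN (x ∷ fvsC M₁) (SubCᶜ-single-rename dM x∉M₁)

SubRᶜ-SubRCᶜ-disjoint : ∀ {θ R R' M α} → SubRᶜ θ R R' → SubRCᶜ θ R M α → ⊥
SubRᶜ-SubRCᶜ-disjoint {θ} (sr-var x∉) (src-var m) = x∉ (∈⇒∈-dom θ m)
SubRᶜ-SubRCᶜ-disjoint (sr-app d _) (src-app h _ _ _) = SubRᶜ-SubRCᶜ-disjoint d h

mutual
  SubCᶜ-deterministic : ∀ {θ M N₁ N₂} → IsSubst θ → SubCᶜ θ M N₁ → SubCᶜ θ M N₂ → N₁ ≡ N₂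
  SubCᶜ-deterministic u (sc-atm a) (sc-atm b) = cong atm (SubRᶜ-deterministic u a b)
  SubCᶜ-deterministic u (sc-atm a) (sc-can b) = ⊥-elim (SubRᶜ-SubRCᶜ-disjoint a b)
  SubCᶜ-deterministic u (sc-can a) (sc-atm b) = ⊥-elim (SubRᶜ-SubRCᶜ-disjoint b a)
  SubCᶜ-deterministic u (sc-can a) (sc-can b) = proj₁ (SubRCᶜ-deterministic u a b)
  SubCᶜ-deterministic u (sc-lam {N = N₁} L f) (sc-lam {N = N₂} L' g) =
    let avoid = L ++ L' ++ fvsC N₁ ++ fvsC N₂
        z = fresh avoid
        z∉L , z∉₁ = ∉-++⁻ L (fresh∉ avoid)
        z∉L' , z∉₂ = ∉-++⁻ L' z∉₁
        z∉N₁ , z∉N₂ = ∉-++⁻ (fvsC N₁) z∉₂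
    in cong lam (openC-injective N₁ N₂ z∉N₁ z∉N₂ (SubCᶜ-deterministic u (f z z∉L) (g z z∉L')))

  SubRCᶜ-deterministic : ∀ {θ R M₁ M₂ α₁ α₂} → IsSubst θ →
                         SubRCᶜ θ R M₁ α₁ → SubRCᶜ θ R M₂ α₂ → M₁ ≡ M₂ × α₁ ≡ α₂
  SubRCᶜ-deterministic {θ} u (src-var m) (src-var m') = IsSubst-functional θ u m m'
  SubRCᶜ-deterministic u (src-app {M'' = M''} {α' = α'} h a L f) (src-app h' a' L' f')
    with SubRCᶜ-deterministic u h h' | SubCᶜ-deterministic u a a'
  ... | refl , refl | refl =
    let x = fresh (L ++ L')
        x∉L , x∉L' = ∉-++⁻ L (fresh∉ (L ++ L'))
    in SubCᶜ-deterministic (IsSubst-single {x} {M''} {α'}) (f x x∉L) (f' x x∉L') , refl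

  SubRᶜ-deterministic : ∀ {θ R R₁ R₂} → IsSubst θ → SubRᶜ θ R R₁ → SubRᶜ θ R R₂ → R₁ ≡ R₂
  SubRᶜ-deterministic u sr-con sr-con = refl
  SubRᶜ-deterministic u (sr-var _) (sr-var _) = refl
  SubRᶜ-deterministic u (sr-app a b) (sr-app a' b') =
    cong₂ app (SubRᶜ-deterministic u a a') (SubCᶜ-deterministic u b b')

SubRCᶜ-single-head : ∀ {x N α R M β} → SubRCᶜ (single x N α) R M β → x ∈ fvsA R
SubRCᶜ-single-head (src-var (here refl)) = here refl
SubRCᶜ-single-head (src-app h _ _ _) = ∈-++⁺ˡ (SubRCᶜ-single-head h)

mutual
  SubCᶜ-single-vacuous : ∀ {x N α M M'} → SubCᶜ (single x N α) M M' → x ∉ fvsC M → M' ≡ M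
  SubCᶜ-single-vacuous (sc-atm d) x∉ = cong atm (SubRᶜ-single-vacuous d x∉)
  SubCᶜ-single-vacuous (sc-can d) x∉ = ⊥-elim (x∉ (SubRCᶜ-single-head d))
  SubCᶜ-single-vacuous {x} (sc-lam {M} {M'} L f) x∉ =
    let avoid = L ++ x ∷ fvsC M ++ fvsC M'
        z = fresh avoid
        z∉L , z∉₁ = ∉-++⁻ L (fresh∉ avoid)
        z∉M , z∉M' = ∉-++⁻ (fvsC M) (λ p → z∉₁ (there p))
        x≢z : x ≢ z
        x≢z e = z∉₁ (here (sym e))
    in cong lam (openC-injective M' M z∉M' z∉M (SubCᶜ-single-vacuous (f z z∉L) (∉-openC 0 z M x≢z x∉)))

  SubRᶜ-single-vacuous : ∀ {x N α R R'} → SubRᶜ (single x N α) R R' → x ∉ fvsA R → R' ≡ R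
  SubRᶜ-single-vacuous sr-con _ = refl
  SubRᶜ-single-vacuous (sr-var _) _ = refl
  SubRᶜ-single-vacuous {R = app R M} (sr-app d e) x∉ =
    cong₂ app (SubRᶜ-single-vacuous d (∉-++⁻ˡ (fvsC M) x∉)) (SubCᶜ-single-vacuous e (∉-++⁻ʳ (fvsA R) x∉))

-- By induction on the size bound n, since the binder case reopens the body.
mutual
  SubCᶜ-single-identity : ∀ n {x N α} M → sizeC M ≤ n → lcC 0 M → x ∉ fvsC M → SubCᶜ (single x N α) M M
  SubCᶜ-single-identity n (atm R) size≤ lM x∉ = sc-atm (SubRᶜ-single-identity n R size≤ lM x∉)
  SubCᶜ-single-identity (suc n) {x} (lam M) (s≤s size≤) lM x∉ = sc-lam (x ∷ []) λ z z∉ →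
    SubCᶜ-single-identity n (openC 0 z M) (subst (_≤ n) (sym (size-openC 0 z M)) size≤) (lc-openC 0 z M lM)
                          (∉-openC 0 z M (λ e → z∉ (here (sym e))) x∉)

  SubRᶜ-single-identity : ∀ n {x N α} R → sizeA R ≤ n → lcA 0 R → x ∉ fvsA R → SubRᶜ (single x N α) R R
  SubRᶜ-single-identity n (con c) _ _ _ = sr-con
  SubRᶜ-single-identity n (fv y) _ _ x∉ = sr-var λ { (here e) → x∉ (here (sym e)) }
  SubRᶜ-single-identity n (app R M) size≤ (lR , lM) x∉ =
    sr-app (SubRᶜ-single-identity n R (≤-trans (m≤n⇒m≤1+n (m≤m+n (sizeA R) (sizeC M))) size≤) lR (∉-++⁻ˡ (fvsC M) x∉))
           (SubCᶜ-single-identity n M (≤-trans (m≤n⇒m≤1+n (m≤n+m (sizeC M) (sizeA R))) size≤) lM (∉-++⁻ʳ (fvsA R) x∉))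

IsSubst-∷ : ∀ {x N α θ} → x ∉ dom θ → IsSubst θ → IsSubst ((x , N , α) ∷ θ)
IsSubst-∷ {θ = θ} x∉ u = ¬Any⇒All¬ (dom θ) x∉ ∷ u

-- θ = θ₂ ∘ θ₁ for the cofinite judgements, θ₁ sends Γ₁ to Γ₂ and θ₂ sends Γ₂ to Γ₃;
-- n bounds the sum of the arities in θ₁ and θ₂ and is the measure of the induction.
record Composes (θ₁ θ₂ θ : Subst) (Γ₁ Γ₂ Γ₃ : PCtx) (n : ℕ) : Set where
  field
    unique₂    : IsSubst θ₂
    sends₁     : Sends θ₁ Γ₁ Γ₂
    sends₂     : Sends θ₂ Γ₂ Γ₃
    bound₁     : ℕ
    bound₂     : ℕ
    below₁     : AritiesBelow bound₁ θ₁
    below₂     : AritiesBelow bound₂ θ₂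
    bounds     : bound₁ + bound₂ ≤ n
    comp-cases : ∀ {x M α} → (x , M , α) ∈ θ →
                 Σ Can (λ M₀ → (x , M₀ , α) ∈ θ₁ × SubCᶜ θ₂ M₀ M) ⊎ ((x , M , α) ∈ θ₂ × x ∉ dom θ₁)
    comp-θ₁    : ∀ {x M₀ M α} → (x , M₀ , α) ∈ θ₁ → SubCᶜ θ₂ M₀ M → (x , M , α) ∈ θ
    comp-θ₂    : ∀ {x M α} → (x , M , α) ∈ θ₂ → x ∉ dom θ₁ → (x , M , α) ∈ θ

  below₁ⁿ : AritiesBelow n θ₁
  below₁ⁿ = AritiesBelow-mono (m+n≤o⇒m≤o bound₁ bounds) below₁

  below₂ⁿ : AritiesBelow n θ₂
  below₂ⁿ = AritiesBelow-mono (m+n≤o⇒n≤o bound₁ bounds) below₂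
open Composes

binderAvoid : Subst → Subst → List Name
binderAvoid θ₁ θ₂ = dom θ₁ ++ fvsRng θ₁ ++ dom θ₂ ++ fvsRng θ₂

Composes-ext : ∀ {θ₁ θ₂ θ Γ₁ Γ₂ Γ₃ n z β} → Composes θ₁ θ₂ θ Γ₁ Γ₂ Γ₃ n → z ∉ binderAvoid θ₁ θ₂ →
               Composes θ₁ θ₂ θ (ext z β Γ₁) (ext z β Γ₂) (ext z β Γ₃) n
Composes-ext {θ₁} {θ₂} h z∉ =
  let z∉dom₁ , z∉₁ = ∉-++⁻ (dom θ₁) z∉
      z∉rng₁ , z∉₂ = ∉-++⁻ (fvsRng θ₁) z∉₁
      z∉dom₂ , z∉rng₂ = ∉-++⁻ (dom θ₂) z∉₂
  in record
  { unique₂ = unique₂ h ; sends₁ = Sends-ext (sends₁ h) z∉dom₁ z∉rng₁ ; sends₂ = Sends-ext (sends₂ h) z∉dom₂ z∉rng₂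
  ; bound₁ = bound₁ h ; bound₂ = bound₂ h ; below₁ = below₁ h ; below₂ = below₂ h ; bounds = bounds h
  ; comp-cases = comp-cases h ; comp-θ₁ = comp-θ₁ h ; comp-θ₂ = comp-θ₂ h }

∉-dom-comp : ∀ {θ₁ θ₂ θ Γ₁ Γ₂ Γ₃ n x} → Composes θ₁ θ₂ θ Γ₁ Γ₂ Γ₃ n → x ∉ dom θ₁ → x ∉ dom θ₂ → x ∉ dom θ
∉-dom-comp {θ₁} {θ₂} {θ} h x∉dom₁ x∉dom₂ x∈ with ∈-dom⇒∈ θ x∈
... | _ , _ , m with comp-cases h m
...   | inj₁ (_ , m₁ , _) = x∉dom₁ (∈⇒∈-dom θ₁ m₁)
...   | inj₂ (m₂ , _) = x∉dom₂ (∈⇒∈-dom θ₂ m₂)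

redex-bound : ∀ {α α' b₁ b₂ n} → aritySize (α' ⟶ α) ≤ b₁ → b₁ + b₂ ≤ suc n → aritySize α' + b₂ ≤ n
redex-bound {α} {α'} {b₁} {b₂} α≤b₁ bounds =
  s≤s⁻¹ (≤-trans (s≤s (+-monoˡ-≤ b₂ (m≤m+n (aritySize α') (aritySize α)))) (≤-trans (+-monoˡ-≤ b₂ α≤b₁) bounds))

-- Substituting the argument first: [N₁/x] followed by θ₂ is ((x , N₂) ∷ θ₂).
Composes-single-left : ∀ {θ₁ θ₂ θ Γ₁ Γ₂ Γ₃ n x N₁ N₂ α' α} → (h : Composes θ₁ θ₂ θ Γ₁ Γ₂ Γ₃ (suc n)) →
                       aritySize (α' ⟶ α) ≤ bound₁ h → x ∉ dom θ₂ → Chk Γ₂ N₁ α' → SubCᶜ θ₂ N₁ N₂ →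
                       Composes (single x N₁ α') θ₂ ((x , N₂ , α') ∷ θ₂) (ext x α' Γ₂) Γ₂ Γ₃ n
Composes-single-left {θ₂ = θ₂} {x = x} {N₁} {N₂} {α'} h α≤b₁ x∉dom tN₁ dN = record
  { unique₂ = unique₂ h ; sends₁ = Sends-single tN₁ ; sends₂ = sends₂ h
  ; bound₁ = aritySize α' ; bound₂ = bound₂ h ; below₁ = AritiesBelow-single ≤-refl ; below₂ = below₂ h
  ; bounds = redex-bound α≤b₁ (bounds h)
  ; comp-cases = λ { (here refl) → inj₁ (N₁ , here refl , dN)
                   ; (there m) → inj₂ (m , λ { (here refl) → x∉dom (∈⇒∈-dom θ₂ m) }) }
  ; comp-θ₁ = λ { (here refl) dM → here (cong (λ t → (x , t , α')) (SubCᶜ-deterministic (unique₂ h) dM dN)) }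
  ; comp-θ₂ = λ m _ → there m }

-- Substituting the argument last: θ₂ followed by [N₂/x] is again ((x , N₂) ∷ θ₂),
-- because x does not occur in the range of θ₂.
Composes-single-right : ∀ {θ₁ θ₂ θ Γ₁ Γ₂ Γ₃ n x N₂ α' α} → (h : Composes θ₁ θ₂ θ Γ₁ Γ₂ Γ₃ (suc n)) →
                        aritySize (α' ⟶ α) ≤ bound₁ h → x ∉ dom θ₂ → x ∉ fvsRng θ₂ → Chk Γ₃ N₂ α' →
                        Composes θ₂ (single x N₂ α') ((x , N₂ , α') ∷ θ₂) (ext x α' Γ₂) (ext x α' Γ₃) Γ₃ n
Composes-single-right {θ₂ = θ₂} {n = n} {x = x} {N₂} {α'} h α≤b₁ x∉dom x∉rng tN₂ = record
  { unique₂ = IsSubst-single {x} {N₂} {α'} ; sends₁ = Sends-ext (sends₂ h) x∉dom x∉rng ; sends₂ = Sends-single tN₂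
  ; bound₁ = bound₂ h ; bound₂ = aritySize α' ; below₁ = below₂ h ; below₂ = AritiesBelow-single ≤-refl
  ; bounds = subst (_≤ n) (+-comm (aritySize α') (bound₂ h)) (redex-bound α≤b₁ (bounds h))
  ; comp-cases = λ { (here refl) → inj₂ (here refl , x∉dom)
                   ; {M = P} (there m) → inj₁ (P , m , SubCᶜ-single-identity (sizeC P) P ≤-refl
                                                         (Chk-lc (rng-Chk (sends₂ h) m)) (x∉P m)) }
  ; comp-θ₁ = λ m dP → there (subst (λ t → (_ , t , _) ∈ θ₂) (sym (SubCᶜ-single-vacuous dP (x∉P m))) m)
  ; comp-θ₂ = λ { (here refl) _ → here refl } }
  where
    x∉P : ∀ {y P β} → (y , P , β) ∈ θ₂ → x ∉ fvsC P
    x∉P m p = x∉rng (∈-fvsRng θ₂ m p)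

mutual
  composeC : ∀ n {θ₁ θ₂ θ Γ₁ Γ₂ Γ₃ M α M' M''} → Composes θ₁ θ₂ θ Γ₁ Γ₂ Γ₃ n →
             Chk Γ₁ M α → SubCᶜ θ₁ M M' → SubCᶜ θ₂ M' M'' → SubCᶜ θ M M''
  composeC n h (chk-atm d) (sc-atm d₁) (sc-atm d₂) = sc-atm (composeR n h d d₁ d₂)
  composeC n h (chk-atm d) (sc-atm d₁) (sc-can d₂)
    with preserveRC n (below₂ⁿ h) (sends₂ h) (preserveR n (below₁ⁿ h) (sends₁ h) d d₁) d₂
  ... | refl , _ = sc-can (composeR-RC n h d d₁ d₂)
  composeC n h (chk-atm d) (sc-can d₁) d₂ with preserveRC n (below₁ⁿ h) (sends₁ h) d d₁
  ... | refl , _ = sc-can (composeRC n h d d₁ d₂)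
  composeC n {θ₁} {θ₂} h (chk-lam L f) (sc-lam L₁ f₁) (sc-lam L₂ f₂) =
    sc-lam (L ++ L₁ ++ L₂ ++ binderAvoid θ₁ θ₂) λ z z∉ →
      let z∉L , z∉₁ = ∉-++⁻ L z∉
          z∉L₁ , z∉₂ = ∉-++⁻ L₁ z∉₁
          z∉L₂ , z∉avoid = ∉-++⁻ L₂ z∉₂
      in composeC n (Composes-ext h z∉avoid) (f z z∉L) (f₁ z z∉L₁) (f₂ z z∉L₂)

  composeR : ∀ n {θ₁ θ₂ θ Γ₁ Γ₂ Γ₃ R α R' R''} → Composes θ₁ θ₂ θ Γ₁ Γ₂ Γ₃ n →
             Syn Γ₁ R α → SubRᶜ θ₁ R R' → SubRᶜ θ₂ R' R'' → SubRᶜ θ R R''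
  composeR n h (syn-con _) sr-con sr-con = sr-con
  composeR n h (syn-var _) (sr-var x∉dom₁) (sr-var x∉dom₂) = sr-var (∉-dom-comp h x∉dom₁ x∉dom₂)
  composeR n h (syn-app d e) (sr-app d₁ e₁) (sr-app d₂ e₂) = sr-app (composeR n h d d₁ d₂) (composeC n h e e₁ e₂)

  composeR-RC : ∀ n {θ₁ θ₂ θ Γ₁ Γ₂ Γ₃ R α R' M''} → Composes θ₁ θ₂ θ Γ₁ Γ₂ Γ₃ n →
                Syn Γ₁ R α → SubRᶜ θ₁ R R' → SubRCᶜ θ₂ R' M'' α → SubRCᶜ θ R M'' α
  composeR-RC n h (syn-var _) (sr-var x∉dom₁) (src-var m) = src-var (comp-θ₂ h m x∉dom₁)
  composeR-RC n h (syn-app d e) (sr-app d₁ e₁) (src-app d₂ e₂ L s)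
    with preserveRC n (below₂ⁿ h) (sends₂ h) (preserveR n (below₁ⁿ h) (sends₁ h) d d₁) d₂
  ... | refl , _ = src-app (composeR-RC n h d d₁ d₂) (composeC n h e e₁ e₂) L s

  composeRC : ∀ n {θ₁ θ₂ θ Γ₁ Γ₂ Γ₃ R α M' M''} → Composes θ₁ θ₂ θ Γ₁ Γ₂ Γ₃ n →
              Syn Γ₁ R α → SubRCᶜ θ₁ R M' α → SubCᶜ θ₂ M' M'' → SubRCᶜ θ R M'' α
  composeRC n h (syn-var _) (src-var m) d₂ = src-var (comp-θ₁ h m d₂)
  composeRC n h (syn-app d e) (src-app d₁ e₁ L₁ s₁) d₂ with preserveRC n (below₁ⁿ h) (sends₁ h) d d₁
  ... | refl , tλ = composeRC-app n h d e d₁ e₁ L₁ s₁ d₂ tλ (proj₂ (existsC n (below₂ⁿ h) (sends₂ h) tλ))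

  composeRC-app : ∀ n {θ₁ θ₂ θ Γ₁ Γ₂ Γ₃ R N α α' M₁ N₁ M' M'' Λ} → Composes θ₁ θ₂ θ Γ₁ Γ₂ Γ₃ n →
                  Syn Γ₁ R (α' ⟶ α) → Chk Γ₁ N α' →
                  SubRCᶜ θ₁ R (lam M₁) (α' ⟶ α) → SubCᶜ θ₁ N N₁ → (L₁ : List Name) →
                  (∀ x → x ∉ L₁ → SubCᶜ (single x N₁ α') (openC 0 x M₁) M') →
                  SubCᶜ θ₂ M' M'' → Chk Γ₂ (lam M₁) (α' ⟶ α) → SubCᶜ θ₂ (lam M₁) Λ →
                  SubRCᶜ θ (app R N) M'' α
  composeRC-app zero h _ _ d₁ _ _ _ _ _ _
    with () ← ≤-trans (SubRCᶜ-arity-below (below₁ h) d₁) (m+n≤o⇒m≤o (bound₁ h) (bounds h))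
  composeRC-app (suc n) {θ₂ = θ₂} h d e d₁ e₁ L₁ s₁ d₂ (chk-lam Lt gl) (sc-lam L₃ f₃) =
    let tN₁ = preserveC (suc n) (below₁ⁿ h) (sends₁ h) e e₁
        N₂ , dN = existsC (suc n) (below₂ⁿ h) (sends₂ h) tN₁
    in src-app (composeRC (suc n) h d d₁ (sc-lam L₃ f₃)) (composeC (suc n) h e e₁ dN)
               (L₁ ++ Lt ++ L₃ ++ dom θ₂ ++ fvsRng θ₂) λ x x∉ →
         let x∉L₁ , x∉₁ = ∉-++⁻ L₁ x∉
             x∉Lt , x∉₂ = ∉-++⁻ Lt x∉₁
             x∉L₃ , x∉₃ = ∉-++⁻ L₃ x∉₂
             x∉dom , x∉rng = ∉-++⁻ (dom θ₂) x∉₃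
         in SubCᶜ-single-commute n h (SubRCᶜ-arity-below (below₁ h) d₁) x∉dom x∉rng
                                 (gl x x∉Lt) tN₁ dN (s₁ x x∉L₁) d₂ (f₃ x x∉L₃)

  -- θ₂ ([N₁/x] B) = [θ₂ N₁ / x] (θ₂ B) for x fresh for θ₂: both sides are the
  -- composite ((x , N₂) ∷ θ₂) applied to B, whose arities are smaller.
  SubCᶜ-single-commute : ∀ n {θ₁ θ₂ θ Γ₁ Γ₂ Γ₃ x α' α B B₂ N₁ N₂ M' M''} →
                         (h : Composes θ₁ θ₂ θ Γ₁ Γ₂ Γ₃ (suc n)) → aritySize (α' ⟶ α) ≤ bound₁ h →
                         x ∉ dom θ₂ → x ∉ fvsRng θ₂ →
                         Chk (ext x α' Γ₂) B α → Chk Γ₂ N₁ α' → SubCᶜ θ₂ N₁ N₂ →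
                         SubCᶜ (single x N₁ α') B M' → SubCᶜ θ₂ M' M'' → SubCᶜ θ₂ B B₂ →
                         SubCᶜ (single x N₂ α') B₂ M''
  SubCᶜ-single-commute n {α' = α'} {N₂ = N₂} h α≤b₁ x∉dom x∉rng tB tN₁ dN dM' dM'' dB₂ =
    let σ₂ = sends₂ h
        tN₂ = preserveC (suc n) (below₂ⁿ h) σ₂ tN₁ dN
        tB₂ = preserveC (suc n) (below₂ⁿ h) (Sends-ext σ₂ x∉dom x∉rng) tB dB₂
        α'≤n = m+n≤o⇒m≤o (aritySize α') (redex-bound α≤b₁ (bounds h))
        M₃ , dM₃ = existsC n (AritiesBelow-single α'≤n) (Sends-single tN₂) tB₂
        via-left = composeC n (Composes-single-left h α≤b₁ x∉dom tN₁ dN) tB dM' dM''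
        via-right = composeC n (Composes-single-right h α≤b₁ x∉dom x∉rng tN₂) tB dB₂ dM₃
    in subst (SubCᶜ _ _) (SubCᶜ-deterministic (IsSubst-∷ {N = N₂} {α = α'} x∉dom (unique₂ h)) via-right via-left) dM₃

composeP : ∀ n {θ₁ θ₂ θ Γ₁ Γ₂ Γ₃ P P' P''} → Composes θ₁ θ₂ θ Γ₁ Γ₂ Γ₃ n →
           RespPᶜ Γ₁ P → SubPᶜ θ₁ P P' → SubPᶜ θ₂ P' P'' → SubPᶜ θ P P''
composeP n h rpᶜ-con sp-con sp-con = sp-con
composeP n h (rpᶜ-app d e) (sp-app d₁ e₁) (sp-app d₂ e₂) = sp-app (composeP n h d d₁ d₂) (composeC n h e e₁ e₂)

composeT : ∀ n {θ₁ θ₂ θ Γ₁ Γ₂ Γ₃ A A' A''} → Composes θ₁ θ₂ θ Γ₁ Γ₂ Γ₃ n →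
           RespTᶜ Γ₁ A → SubTᶜ θ₁ A A' → SubTᶜ θ₂ A' A'' → SubTᶜ θ A A''
composeT n h (rtᶜ-atm d) (st-atm d₁) (st-atm d₂) = st-atm (composeP n h d d₁ d₂)
composeT n {θ₁} {θ₂} h (rtᶜ-pi d L f) (st-pi d₁ L₁ f₁) (st-pi d₂ L₂ f₂) =
  st-pi (composeT n h d d₁ d₂) (L ++ L₁ ++ L₂ ++ binderAvoid θ₁ θ₂) λ z z∉ →
    let z∉L , z∉₁ = ∉-++⁻ L z∉
        z∉L₁ , z∉₂ = ∉-++⁻ L₁ z∉₁
        z∉L₂ , z∉avoid = ∉-++⁻ L₂ z∉₂
    in composeT n (Composes-ext h z∉avoid) (f z z∉L) (f₁ z z∉L₁) (f₂ z z∉L₂)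

composeK : ∀ n {θ₁ θ₂ θ Γ₁ Γ₂ Γ₃ K K' K''} → Composes θ₁ θ₂ θ Γ₁ Γ₂ Γ₃ n →
           RespKᶜ Γ₁ K → SubKᶜ θ₁ K K' → SubKᶜ θ₂ K' K'' → SubKᶜ θ K K''
composeK n h rkᶜ-type sk-type sk-type = sk-type
composeK n {θ₁} {θ₂} h (rkᶜ-pi d L f) (sk-pi d₁ L₁ f₁) (sk-pi d₂ L₂ f₂) =
  sk-pi (composeT n h d d₁ d₂) (L ++ L₁ ++ L₂ ++ binderAvoid θ₁ θ₂) λ z z∉ →
    let z∉L , z∉₁ = ∉-++⁻ L z∉
        z∉L₁ , z∉₂ = ∉-++⁻ L₁ z∉₁
        z∉L₂ , z∉avoid = ∉-++⁻ L₂ z∉₂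
    in composeK n (Composes-ext h z∉avoid) (f z z∉L) (f₁ z z∉L₁) (f₂ z z∉L₂)

FvsResult : Subst → List Name → Name → Set
FvsResult θ xs x = (x ∈ xs × x ∉ dom θ) ⊎ x ∈ fvsRng θ

FvsResult-++⁺ˡ : ∀ {θ x xs} ys → FvsResult θ xs x → FvsResult θ (xs ++ ys) x
FvsResult-++⁺ˡ ys = Sum.map₁ (Product.map₁ ∈-++⁺ˡ)

FvsResult-++⁺ʳ : ∀ {θ x ys} xs → FvsResult θ ys x → FvsResult θ (xs ++ ys) x
FvsResult-++⁺ʳ xs = Sum.map₁ (Product.map₁ (∈-++⁺ʳ xs))

mutual
  fvs-SubC : ∀ {θ M N x} → SubC θ M N → x ∈ fvsC N → FvsResult θ (fvsC M) x
  fvs-SubC (c-atm d) = fvs-SubR d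
  fvs-SubC (c-can d) = fvs-SubRC d
  fvs-SubC (c-lam {M} {N} z _ _ _ d) p with fvs-closeC 0 z N p
  ... | q , x≢z with fvs-SubC d q
  ...   | inj₂ r = inj₂ r
  ...   | inj₁ (r , x∉dom) = inj₁ (Sum.[ (λ e → ⊥-elim (x≢z e)) , (λ s → s) ] (fvs-openC 0 z M r) , x∉dom)

  fvs-SubRC : ∀ {θ R M α x} → SubRC θ R M α → x ∈ fvsC M → FvsResult θ (fvsA R) x
  fvs-SubRC {θ} (rc-var m) p = inj₂ (∈-fvsRng θ m p)
  fvs-SubRC (rc-app {R = R} {M = M} {M₁ = M₁} {M'' = M''} h d z _ e) p with fvs-SubC e p
  ... | inj₁ (q , x∉z) with fvs-openC 0 z M₁ q
  ...   | inj₁ refl = ⊥-elim (x∉z (here refl))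
  ...   | inj₂ r = FvsResult-++⁺ˡ (fvsC M) (fvs-SubRC h r)
  fvs-SubRC (rc-app {R = R} {M'' = M''} h d z _ e) p | inj₂ q with ∈-++⁻ (fvsC M'') q
  ... | inj₁ r = FvsResult-++⁺ʳ (fvsA R) (fvs-SubC d r)

  fvs-SubR : ∀ {θ R R' x} → SubR θ R R' → x ∈ fvsA R' → FvsResult θ (fvsA R) x
  fvs-SubR (r-var x∉) (here refl) = inj₁ (here refl , x∉)
  fvs-SubR (r-app {R = R} {R' = R'} {M = M} d e) p with ∈-++⁻ (fvsA R') p
  ... | inj₁ q = FvsResult-++⁺ˡ (fvsC M) (fvs-SubR d q)
  ... | inj₂ q = FvsResult-++⁺ʳ (fvsA R) (fvs-SubC e q)

maxArity : Subst → ℕ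
maxArity θ = max 0 (map (λ (_ , _ , α) → aritySize α) θ)

AritiesBelow-maxArity : ∀ θ → AritiesBelow (maxArity θ) θ
AritiesBelow-maxArity θ m = All.lookup (xs≤max 0 _) (∈-map⁺ _ m)

∈-ctx⁺ : ∀ {x M α} θ → (x , M , α) ∈ θ → (var x , α) ∈ ctx θ
∈-ctx⁺ θ = ∈-map⁺ _

∈-ctx⁻ : ∀ {s β} θ → (s , β) ∈ ctx θ → Σ Name λ y → Σ Can λ M → s ≡ var y × (y , M , β) ∈ θ
∈-ctx⁻ θ p with ∈-map⁻ _ p
... | (y , M , _) , m , refl = y , M , refl , m

∈-ctx-⊕-functional : ∀ {x M α β} θ Θ → IsSubst θ → (x , M , α) ∈ θ → (var x , β) ∈ ctx θ ⊕ Θ → α ≡ β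
∈-ctx-⊕-functional θ Θ u m p with ∈-⊕⁻ (ctx θ) Θ p
... | inj₂ (_ , unassigned) = ⊥-elim (¬assigned⇒∉ (ctx θ) unassigned (∈-ctx⁺ θ m))
... | inj₁ q with ∈-ctx⁻ θ q
...   | _ , _ , refl , m' = proj₂ (IsSubst-functional θ u m m')

∈-ctx-⊕-NotDom : ∀ {s β} θ Θ → (s , β) ∈ ctx θ ⊕ Θ → NotDom s θ → (s , β) ∈ Θ
∈-ctx-⊕-NotDom θ Θ p s∉ with ∈-⊕⁻ (ctx θ) Θ p
... | inj₂ (q , _) = q
... | inj₁ q with ∈-ctx⁻ θ q
...   | _ , _ , refl , m = ⊥-elim (s∉ (∈⇒∈-dom θ m))

module Composition (Θ : ArCtx) (θ₁ θ₂ θ : Subst) (u₂ : IsSubst θ₂) (u : IsSubst θ)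
                   (compat : Compatible θ₁ θ₂ Θ) (comp : IsComposition θ₂ θ₁ θ) where

  Γ₁ Γ₂ Γ₃ : PCtx
  Γ₁ = ⟦ ctx θ ⊕ Θ ⟧
  Γ₂ = ⟦ ctx θ₂ ⊕ Θ ⟧
  Γ₃ = ⟦ Θ ⟧

  comp⁻ : ∀ {x M α} → (x , M , α) ∈ θ →
          Σ Can (λ M₀ → (x , M₀ , α) ∈ θ₁ × SubC θ₂ M₀ M) ⊎ ((x , M , α) ∈ θ₂ × x ∉ dom θ₁)
  comp⁻ {x} {M} {α} = proj₁ (comp x M α)

  comp⁺ : ∀ {x M α} → Σ Can (λ M₀ → (x , M₀ , α) ∈ θ₁ × SubC θ₂ M₀ M) ⊎ ((x , M , α) ∈ θ₂ × x ∉ dom θ₁) →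
          (x , M , α) ∈ θ
  comp⁺ {x} {M} {α} = proj₂ (comp x M α)

  rng₂-Chk : ∀ {x M α} → (x , M , α) ∈ θ₂ → Chk Γ₃ M α
  rng₂-Chk m = ⊢⇐⇒Chk (proj₁ compat m) (Agree-refl _)

  rng₁-Chk : ∀ {x M α} → (x , M , α) ∈ θ₁ → Chk Γ₂ M α
  rng₁-Chk m = ⊢⇐⇒Chk (proj₂ compat m) (Agree-refl _)

  lc-rng₁ : LcRng θ₁
  lc-rng₁ m = Chk-lc (rng₁-Chk m)

  lc-rng₂ : LcRng θ₂
  lc-rng₂ m = Chk-lc (rng₂-Chk m)

  sends₂-Θ : Sends θ₂ Γ₂ Γ₃
  sends₂-Θ = record
    { rng-Chk = rng₂-Chk ; keep = ∈-ctx-⊕-NotDom θ₂ Θ ; arity-match = ∈-ctx-⊕-functional θ₂ Θ u₂ }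

  keep₁ : ∀ {s β} → (s , β) ∈ ctx θ ⊕ Θ → NotDom s θ₁ → (s , β) ∈ ctx θ₂ ⊕ Θ
  keep₁ p s∉ with ∈-⊕⁻ (ctx θ) Θ p
  keep₁ p s∉ | inj₁ q with ∈-ctx⁻ θ q
  ... | _ , _ , refl , m with comp⁻ m
  ...   | inj₁ (_ , m₁ , _) = ⊥-elim (s∉ (∈⇒∈-dom θ₁ m₁))
  ...   | inj₂ (m₂ , _) = ∈-++⁺ˡ (∈-ctx⁺ θ₂ m₂)
  keep₁ {s} p s∉ | inj₂ (q , unassigned) with assigned s (ctx θ₂) in e
  ... | false = ∈-⊕⁺ʳ (ctx θ₂) Θ q e
  ... | true with assigned⇒∈ s (ctx θ₂) e
  ...   | _ , r with ∈-ctx⁻ θ₂ r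
  ...     | _ , _ , refl , m₂ = ⊥-elim (¬assigned⇒∉ (ctx θ) unassigned (∈-ctx⁺ θ (comp⁺ (inj₂ (m₂ , s∉)))))

  -- The arity of x in θ₁ is read off the entry of x in θ, which exists since θ₂
  -- can be applied to the θ₁-image of x.
  arity-match₁ : ∀ {x M α β} → (x , M , α) ∈ θ₁ → (var x , β) ∈ ctx θ ⊕ Θ → α ≡ β
  arity-match₁ m₁ p with existsC _ (AritiesBelow-maxArity θ₂) sends₂-Θ (rng₁-Chk m₁)
  ... | _ , d = ∈-ctx-⊕-functional θ Θ u (comp⁺ (inj₁ (_ , m₁ , SubCᶜ⇒SubC d))) p

  sends₁-Θ : Sends θ₁ Γ₁ Γ₂
  sends₁-Θ = record { rng-Chk = rng₁-Chk ; keep = keep₁ ; arity-match = arity-match₁ }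

  n : ℕ
  n = maxArity θ₁ + maxArity θ₂

  composes : Composes θ₁ θ₂ θ Γ₁ Γ₂ Γ₃ n
  composes = record
    { unique₂ = u₂ ; sends₁ = sends₁-Θ ; sends₂ = sends₂-Θ
    ; bound₁ = maxArity θ₁ ; bound₂ = maxArity θ₂
    ; below₁ = AritiesBelow-maxArity θ₁ ; below₂ = AritiesBelow-maxArity θ₂ ; bounds = ≤-refl
    ; comp-cases = λ m → Sum.map₁ (λ (M₀ , m₁ , d) → M₀ , m₁ , proj₁ (SubC⇒SubCᶜ lc-rng₂ (lc-rng₁ m₁) d)) (comp⁻ m)
    ; comp-θ₁ = λ m₁ d → comp⁺ (inj₁ (_ , m₁ , SubCᶜ⇒SubC d))
    ; comp-θ₂ = λ m₂ x∉ → comp⁺ (inj₂ (m₂ , x∉)) }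

  compose-SubC : ∀ M α M' M'' → ctx θ ⊕ Θ ⊢ M ⇐ α → SubC θ₁ M M' → SubC θ₂ M' M'' → SubC θ M M''
  compose-SubC M α M' M'' t d₁ d₂ =
    let tM = ⊢⇐⇒Chk t (Agree-refl _)
        d₁ᶜ , lM' = SubC⇒SubCᶜ lc-rng₁ (Chk-lc tM) d₁
    in SubCᶜ⇒SubC (composeC n composes tM d₁ᶜ (proj₁ (SubC⇒SubCᶜ lc-rng₂ lM' d₂)))

  compose-SubRC : ∀ R α M' M'' → ctx θ ⊕ Θ ⊢ R ⇒ α → SubRC θ₁ R M' α → SubC θ₂ M' M'' → SubRC θ R M'' α
  compose-SubRC R α M' M'' t d₁ d₂ =
    let tR = ⊢⇒⇒Syn t (Agree-refl _)
        d₁ᶜ , lM' = SubRC⇒SubRCᶜ lc-rng₁ (Syn-lc tR) d₁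
    in SubRCᶜ⇒SubRC (composeRC n composes tR d₁ᶜ (proj₁ (SubC⇒SubCᶜ lc-rng₂ lM' d₂)))

  compose-SubR-SubRC : ∀ R α R' M'' → ctx θ ⊕ Θ ⊢ R ⇒ α → SubR θ₁ R R' → SubRC θ₂ R' M'' α → SubRC θ R M'' α
  compose-SubR-SubRC R α R' M'' t d₁ d₂ =
    let tR = ⊢⇒⇒Syn t (Agree-refl _)
        d₁ᶜ , lR' = SubR⇒SubRᶜ lc-rng₁ (Syn-lc tR) d₁
    in SubRCᶜ⇒SubRC (composeR-RC n composes tR d₁ᶜ (proj₁ (SubRC⇒SubRCᶜ lc-rng₂ lR' d₂)))

  compose-SubR : ∀ R α R' R'' → ctx θ ⊕ Θ ⊢ R ⇒ α → SubR θ₁ R R' → SubR θ₂ R' R'' → SubR θ R R''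
  compose-SubR R α R' R'' t d₁ d₂ =
    let tR = ⊢⇒⇒Syn t (Agree-refl _)
        d₁ᶜ , lR' = SubR⇒SubRᶜ lc-rng₁ (Syn-lc tR) d₁
    in SubRᶜ⇒SubR (composeR n composes tR d₁ᶜ (proj₁ (SubR⇒SubRᶜ lc-rng₂ lR' d₂)))

  compose-SubT : ∀ E E' E'' → RespT (ctx θ ⊕ Θ) E → SubT θ₁ E E' → SubT θ₂ E' E'' → SubT θ E E''
  compose-SubT E E' E'' r d₁ d₂ =
    let rE = RespT⇒RespTᶜ r (Agree-refl _)
        d₁ᶜ , lE' = SubT⇒SubTᶜ lc-rng₁ (RespTᶜ-lc rE) d₁
    in SubTᶜ⇒SubT (composeT n composes rE d₁ᶜ (proj₁ (SubT⇒SubTᶜ lc-rng₂ lE' d₂)))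

  compose-SubK : ∀ E E' E'' → RespK (ctx θ ⊕ Θ) E → SubK θ₁ E E' → SubK θ₂ E' E'' → SubK θ E E''
  compose-SubK E E' E'' r d₁ d₂ =
    let rE = RespK⇒RespKᶜ r (Agree-refl _)
        d₁ᶜ , lE' = SubK⇒SubKᶜ lc-rng₁ (RespKᶜ-lc rE) d₁
    in SubKᶜ⇒SubK (composeK n composes rE d₁ᶜ (proj₁ (SubK⇒SubKᶜ lc-rng₂ lE' d₂)))

  FreshRng-comp : ∀ {x} → FreshRng x θ₁ → FreshRng x θ₂ → FreshRng x θ
  FreshRng-comp {x} fr₁ fr₂ = All.tabulate λ m x∈ → Sum.[ via-θ₁ x∈ , (λ (m₂ , _) → All.lookup fr₂ m₂ x∈) ] (comp⁻ m)
    where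
      via-θ₁ : ∀ {y P β} → x ∈ fvsC P → Σ Can (λ M₀ → (y , M₀ , β) ∈ θ₁ × SubC θ₂ M₀ P) → ⊥
      via-θ₁ x∈ (_ , m₁ , d) with fvs-SubC d x∈
      ... | inj₁ (x∈M₀ , _) = All.lookup fr₁ m₁ x∈M₀
      ... | inj₂ x∈rng = FreshRng⇒∉-fvsRng θ₂ fr₂ x∈rng

  compose-SubΓ : ∀ E E' E'' → RespΓ (ctx θ ⊕ Θ) E → SubΓ θ₁ E E' → SubΓ θ₂ E' E'' → SubΓ θ E E''
  compose-SubΓ _ _ _ rg-emp g-emp g-emp = g-emp
  compose-SubΓ _ _ _ (rg-ext r rA) (g-ext x∉dom₁ fr₁ s₁ t₁) (g-ext x∉dom₂ fr₂ s₂ t₂) =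
    g-ext (∉-dom-comp composes x∉dom₁ x∉dom₂) (FreshRng-comp fr₁ fr₂)
          (compose-SubΓ _ _ _ r s₁ s₂) (compose-SubT _ _ _ rA t₁ t₂)

theorem2p5 : (Θ : ArCtx) (θ₁ θ₂ θ : Subst) →
    IsArCtx Θ → IsSubst θ₁ → IsSubst θ₂ →
    Compatible θ₁ θ₂ Θ →
    IsSubst θ → IsComposition θ₂ θ₁ θ →
    (∀ E E' E'' → RespK (ctx θ ⊕ Θ) E → SubK θ₁ E E' → SubK θ₂ E' E'' → SubK θ E E'')
    × (∀ E E' E'' → RespT (ctx θ ⊕ Θ) E → SubT θ₁ E E' → SubT θ₂ E' E'' → SubT θ E E'')
    × (∀ E E' E'' → RespΓ (ctx θ ⊕ Θ) E → SubΓ θ₁ E E' → SubΓ θ₂ E' E'' → SubΓ θ E E'')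
    × (∀ M α M' M'' → ctx θ ⊕ Θ ⊢ M ⇐ α → SubC θ₁ M M' → SubC θ₂ M' M'' → SubC θ M M'')
    × (∀ R α M' M'' → ctx θ ⊕ Θ ⊢ R ⇒ α → SubRC θ₁ R M' α → SubC θ₂ M' M'' → SubRC θ R M'' α)
    × (∀ R α R' M'' → ctx θ ⊕ Θ ⊢ R ⇒ α → SubR θ₁ R R' → SubRC θ₂ R' M'' α → SubRC θ R M'' α)
    × (∀ R α R' R'' → ctx θ ⊕ Θ ⊢ R ⇒ α → SubR θ₁ R R' → SubR θ₂ R' R'' → SubR θ R R'')
theorem2p5 Θ θ₁ θ₂ θ _ _ u₂ compat u comp =
  compose-SubK , compose-SubT , compose-SubΓ , compose-SubC , compose-SubRC , compose-SubR-SubRC , compose-SubR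
  where open Composition Θ θ₁ θ₂ θ u₂ u compat comp
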